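{- Let $T$ be a commutative strong Frobenius monad on a symmetric monoidal dagger category $\mathcal{C}$. Then the Kleisli category $\mathcal{C}_T$ is a symmetric monoidal dagger category, with tensor $A\otimes_T B=A\otimes B$ on objects, $f\otimes_T g=\mathrm{dst}\circ(f\otimes g)$ on morphisms, coherence isomorphisms and symmetry the images of those of $\mathcal{C}$ under the canonical functor $\mathcal{C}\to\mathcal{C}_T$, and dagger sending $f\colon A\to T(B)$ to $T(f^\dagger)\circ\mu_B^\dagger\circ\eta_B$.
   Context: A dagger category has an identity-on-objects contravariant functor $f\mapsto f^\dagger$ with $f^{\dagger\dagger}=f$; $f$ is unitary if $f^\dagger=f^{ -1}$. A symmetric monoidal dagger category is a symmetric monoidal category with a dagger such that $(f\otimes g)^\dagger=f^\dagger\otimes g^\dagger$ and associators, unitors and symmetries $\sigma$ are unitary. A Frobenius monad is a monad $(T,\mu,\eta)$ with $T(f^\dagger)=T(f)^\dagger$ and $T(\mu_A)\circ\mu^\dagger_{T(A)}=\mu_{T(A)}\circ T(\mu_A^\dagger)$. A strong monad has a natural transformation $\mathrm{st}_{A,B}\colon A\otimes T(B)\to T(A\otimes B)$ with $\mathrm{st}\circ\alpha=T(\alpha)\circ\mathrm{st}\circ(\mathrm{id}\otimes\mathrm{st})$, $T(\lambda)\circ\mathrm{st}=\lambda$, $\mathrm{st}\circ(\mathrm{id}\otimes\mu)=\mu\circ T(\mathrm{st})\circ\mathrm{st}$, $\mathrm{st}\circ(\mathrm{id}\otimes\eta)=\eta$. A strong Frobenius monad is a Frobenius monad that is a strong monad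 with each $\mathrm{st}$ unitary. Define $\mathrm{st}'_{A,B}=T(\sigma_{B,A})\circ\mathrm{st}_{B,A}\circ\sigma_{T(A),B}\colon T(A)\otimes B\to T(A\otimes B)$, $\mathrm{dst}_{A,B}=\mu_{A\otimes B}\circ T(\mathrm{st}'_{A,B})\circ\mathrm{st}_{T(A),B}$ and $\mathrm{dst}'_{A,B}=\mu_{A\otimes B}\circ T(\mathrm{st}_{A,B})\circ\mathrm{st}'_{A,T(B)}$, both $T(A)\otimes T(B)\to T(A\otimes B)$; the strong monad is commutative when $\mathrm{dst}=\mathrm{dst}'$. The Kleisli category $\mathcal{C}_T$ has the objects of $\mathcal{C}$, morphisms $A\to B$ the morphisms $A\to T(B)$, identities $\eta$, composition $g\circ_T f=\mu\circ T(g)\circ f$; the canonical functor $\mathcal{C}\to\mathcal{C}_T$ sends $f\mapsto\eta\circ f$. -}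

module Defs where

open import Level using (Level; _⊔_) renaming (suc to lsuc)
open import Relation.Binary.PropositionalEquality using (_≡_)
open import Data.Product using (Σ; _×_)

record RawCategory (o ℓ : Level) : Set (lsuc (o ⊔ ℓ)) where
  infixr 9 _∘_
  field
    Obj : Set o
    Hom : Obj → Obj → Set ℓ
    id  : ∀ {A} → Hom A A
    _∘_ : ∀ {A B C} → Hom B C → Hom A B → Hom A C

record IsCategory {o ℓ} (C : RawCategory o ℓ) : Set (o ⊔ ℓ) where
  open RawCategory C
  field
    assoc     : ∀ {A B C D} (f : Hom A B) (g : Hom B C) (h : Hom C D) →
                (h ∘ g) ∘ f ≡ h ∘ (g ∘ f)
    identityˡ : ∀ {A B} (f : Hom A B) → id ∘ f ≡ f
    identityʳ : ∀ {A B} (f : Hom A B) → f ∘ id ≡ f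

module _ {o ℓ} (C : RawCategory o ℓ) where
  open RawCategory C

  IsIso : ∀ {A B} → Hom A B → Set ℓ
  IsIso {A} {B} f = Σ (Hom B A) (λ g → (g ∘ f ≡ id) × (f ∘ g ≡ id))

  record IsDagger († : ∀ {A B} → Hom A B → Hom B A) : Set (o ⊔ ℓ) where
    field
      †-identity : ∀ {A} → † (id {A}) ≡ id
      †-homomorphism : ∀ {A B C} (f : Hom A B) (g : Hom B C) →
                       † (g ∘ f) ≡ † f ∘ † g
      †-involutive : ∀ {A B} (f : Hom A B) → † († f) ≡ f

  IsUnitary : († : ∀ {A B} → Hom A B → Hom B A) → ∀ {A B} → Hom A B → Set ℓ
  IsUnitary † f = († f ∘ f ≡ id) × (f ∘ † f ≡ id)

record MonoidalData {o ℓ} (C : RawCategory o ℓ) : Set (o ⊔ ℓ) where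
  open RawCategory C
  infixr 10 _⊗₀_ _⊗₁_
  field
    _⊗₀_ : Obj → Obj → Obj
    _⊗₁_ : ∀ {A B A' B'} → Hom A B → Hom A' B' → Hom (A ⊗₀ A') (B ⊗₀ B')
    unit : Obj
    α    : ∀ A B C → Hom (A ⊗₀ (B ⊗₀ C)) ((A ⊗₀ B) ⊗₀ C)
    λ'   : ∀ A → Hom (unit ⊗₀ A) A
    ρ    : ∀ A → Hom (A ⊗₀ unit) A
    σ    : ∀ A B → Hom (A ⊗₀ B) (B ⊗₀ A)

record IsSymmetricMonoidal {o ℓ} (𝒟 : RawCategory o ℓ) (M : MonoidalData 𝒟)
       : Set (o ⊔ ℓ) where
  open RawCategory 𝒟
  open MonoidalData M
  field
    ⊗-identity : ∀ {A B} → id {A} ⊗₁ id {B} ≡ id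
    ⊗-homomorphism : ∀ {A B C A' B' C'} (f : Hom A B) (g : Hom B C)
                     (f' : Hom A' B') (g' : Hom B' C') →
                     (g ∘ f) ⊗₁ (g' ∘ f') ≡ (g ⊗₁ g') ∘ (f ⊗₁ f')
    α-natural : ∀ {A B C A' B' C'} (f : Hom A A') (g : Hom B B') (h : Hom C C') →
                α A' B' C' ∘ (f ⊗₁ (g ⊗₁ h)) ≡ ((f ⊗₁ g) ⊗₁ h) ∘ α A B C
    λ-natural : ∀ {A B} (f : Hom A B) → λ' B ∘ (id ⊗₁ f) ≡ f ∘ λ' A
    ρ-natural : ∀ {A B} (f : Hom A B) → ρ B ∘ (f ⊗₁ id) ≡ f ∘ ρ A
    σ-natural : ∀ {A B A' B'} (f : Hom A A') (g : Hom B B') →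
                σ A' B' ∘ (f ⊗₁ g) ≡ (g ⊗₁ f) ∘ σ A B
    α-iso : ∀ A B C → IsIso 𝒟 (α A B C)
    λ-iso : ∀ A → IsIso 𝒟 (λ' A)
    ρ-iso : ∀ A → IsIso 𝒟 (ρ A)
    σ-iso : ∀ A B → IsIso 𝒟 (σ A B)
    pentagon : ∀ A B C D →
               α (A ⊗₀ B) C D ∘ α A B (C ⊗₀ D)
               ≡ (α A B C ⊗₁ id {D}) ∘ (α A (B ⊗₀ C) D ∘ (id {A} ⊗₁ α B C D))
    triangle : ∀ A B → (ρ A ⊗₁ id {B}) ∘ α A unit B ≡ id {A} ⊗₁ λ' B
    hexagon  : ∀ A B C →
               α C A B ∘ (σ (A ⊗₀ B) C ∘ α A B C)
               ≡ (σ A C ⊗₁ id {B}) ∘ (α A C B ∘ (id {A} ⊗₁ σ B C))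
    symmetry : ∀ A B → σ B A ∘ σ A B ≡ id

record IsSymmetricMonoidalDagger {o ℓ} (𝒟 : RawCategory o ℓ)
       († : ∀ {A B} → RawCategory.Hom 𝒟 A B → RawCategory.Hom 𝒟 B A)
       (M : MonoidalData 𝒟) : Set (o ⊔ ℓ) where
  open RawCategory 𝒟
  open MonoidalData M
  field
    isCategory : IsCategory 𝒟
    isDagger   : IsDagger 𝒟 †
    isSymmetricMonoidal : IsSymmetricMonoidal 𝒟 M
    †-⊗ : ∀ {A B A' B'} (f : Hom A B) (g : Hom A' B') → † (f ⊗₁ g) ≡ † f ⊗₁ † g
    α-unitary : ∀ A B C → IsUnitary 𝒟 † (α A B C)
    λ-unitary : ∀ A → IsUnitary 𝒟 † (λ' A)
    ρ-unitary : ∀ A → IsUnitary 𝒟 † (ρ A)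
    σ-unitary : ∀ A B → IsUnitary 𝒟 † (σ A B)

record SymmetricMonoidalDaggerCategory (o ℓ : Level) : Set (lsuc (o ⊔ ℓ)) where
  field
    raw : RawCategory o ℓ
  open RawCategory raw
  field
    †        : ∀ {A B} → Hom A B → Hom B A
    monoidal : MonoidalData raw
    isSMD    : IsSymmetricMonoidalDagger raw † monoidal
  open RawCategory raw public
  open MonoidalData monoidal public

module _ {o ℓ} (𝒞 : SymmetricMonoidalDaggerCategory o ℓ) where
  open SymmetricMonoidalDaggerCategory 𝒞

  record Monad : Set (o ⊔ ℓ) where
    field
      T₀ : Obj → Obj
      T₁ : ∀ {A B} → Hom A B → Hom (T₀ A) (T₀ B)
      μ  : ∀ A → Hom (T₀ (T₀ A)) (T₀ A)
      η  : ∀ A → Hom A (T₀ A)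
      T-identity : ∀ {A} → T₁ (id {A}) ≡ id
      T-homomorphism : ∀ {A B C} (f : Hom A B) (g : Hom B C) →
                       T₁ (g ∘ f) ≡ T₁ g ∘ T₁ f
      μ-natural : ∀ {A B} (f : Hom A B) → μ B ∘ T₁ (T₁ f) ≡ T₁ f ∘ μ A
      η-natural : ∀ {A B} (f : Hom A B) → η B ∘ f ≡ T₁ f ∘ η A
      μ-assoc   : ∀ A → μ A ∘ T₁ (μ A) ≡ μ A ∘ μ (T₀ A)
      μ-unitˡ   : ∀ A → μ A ∘ T₁ (η A) ≡ id
      μ-unitʳ   : ∀ A → μ A ∘ η (T₀ A) ≡ id

  module _ (𝕋 : Monad) where
    open Monad 𝕋

    record IsFrobenius : Set (o ⊔ ℓ) where
      field
        T-† : ∀ {A B} (f : Hom A B) → T₁ († f) ≡ † (T₁ f)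
        frobenius : ∀ A → T₁ (μ A) ∘ † (μ (T₀ A)) ≡ μ (T₀ A) ∘ T₁ († (μ A))

    record IsStrong (st : ∀ A B → Hom (A ⊗₀ T₀ B) (T₀ (A ⊗₀ B))) : Set (o ⊔ ℓ) where
      field
        st-natural : ∀ {A B A' B'} (f : Hom A A') (g : Hom B B') →
                     st A' B' ∘ (f ⊗₁ T₁ g) ≡ T₁ (f ⊗₁ g) ∘ st A B
        st-α : ∀ A B C →
               st (A ⊗₀ B) C ∘ α A B (T₀ C)
               ≡ T₁ (α A B C) ∘ (st A (B ⊗₀ C) ∘ (id {A} ⊗₁ st B C))
        st-λ : ∀ A → T₁ (λ' A) ∘ st unit A ≡ λ' (T₀ A)
        st-μ : ∀ A B → st A B ∘ (id {A} ⊗₁ μ B)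
                       ≡ μ (A ⊗₀ B) ∘ (T₁ (st A B) ∘ st A (T₀ B))
        st-η : ∀ A B → st A B ∘ (id {A} ⊗₁ η B) ≡ η (A ⊗₀ B)

    module Strength (st : ∀ A B → Hom (A ⊗₀ T₀ B) (T₀ (A ⊗₀ B))) where
      st' : ∀ A B → Hom (T₀ A ⊗₀ B) (T₀ (A ⊗₀ B))
      st' A B = T₁ (σ B A) ∘ (st B A ∘ σ (T₀ A) B)

      dst : ∀ A B → Hom (T₀ A ⊗₀ T₀ B) (T₀ (A ⊗₀ B))
      dst A B = μ (A ⊗₀ B) ∘ (T₁ (st' A B) ∘ st (T₀ A) B)

      dst' : ∀ A B → Hom (T₀ A ⊗₀ T₀ B) (T₀ (A ⊗₀ B))
      dst' A B = μ (A ⊗₀ B) ∘ (T₁ (st A B) ∘ st' A (T₀ B))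

      IsCommutative : Set (o ⊔ ℓ)
      IsCommutative = ∀ A B → dst A B ≡ dst' A B

      record IsCommutativeStrongFrobenius : Set (o ⊔ ℓ) where
        field
          isFrobenius : IsFrobenius
          isStrong    : IsStrong st
          st-unitary  : ∀ A B → IsUnitary raw † (st A B)
          commutative : IsCommutative

      kleisli : RawCategory o ℓ
      kleisli = record
        { Obj = Obj
        ; Hom = λ A B → Hom A (T₀ B)
        ; id  = λ {A} → η A
        ; _∘_ = λ {A} {B} {C} g f → μ C ∘ (T₁ g ∘ f)
        }

      J : ∀ {A B} → Hom A B → Hom A (T₀ B)
      J {A} {B} f = η B ∘ f

      kleisli-† : ∀ {A B} → Hom A (T₀ B) → Hom B (T₀ A)
      kleisli-† {A} {B} f = T₁ († f) ∘ († (μ B) ∘ η B)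

      kleisli-monoidal : MonoidalData kleisli
      kleisli-monoidal = record
        { _⊗₀_ = _⊗₀_
        ; _⊗₁_ = λ {A} {B} {A'} {B'} f g → dst B B' ∘ (f ⊗₁ g)
        ; unit = unit
        ; α    = λ A B C → J (α A B C)
        ; λ'   = λ A → J (λ' A)
        ; ρ    = λ A → J (ρ A)
        ; σ    = λ A B → J (σ A B)
        }

-- The Kleisli tensor factors as f ⊗ₖ g = (f ⊗ʳ B') ∙ (A ⊗ˡ g), where X ⊗ˡ g = st ∘ (id ⊗ g)
-- and f ⊗ʳ Y = st' ∘ (f ⊗ id) are functors on the Kleisli category by the strength axioms;
-- commutativity of the monad says exactly that they interchange, which gives bifunctoriality.
-- Naturality of the coherence maps can be checked one variable at a time. For ⊗ˡ it is the
-- strength axioms; since f ⊗ʳ Y = σ ∙ (Y ⊗ˡ f) ∙ σ, the remaining cases reduce to these and to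
-- coherence of 𝒞. The coherence axioms themselves are images of those of 𝒞 under J.
-- For the dagger, the Frobenius law makes f ↦ T(f†) ∘ μ† ∘ η a contravariant involution,
-- unitarity of the strength makes it commute with ⊗ˡ, hence (conjugating by σ) with ⊗ʳ, and
-- a final interchange gives (f ⊗ₖ g)† = f† ⊗ₖ g†.

module Submission where

open import Relation.Binary.PropositionalEquality
  using (_≡_; sym; trans; cong; cong₂; module ≡-Reasoning)
open import Data.Product using (_,_; proj₁; proj₂)
open import Defs

module CategoryReasoning {o ℓ} (𝒟 : RawCategory o ℓ) (isCategory : IsCategory 𝒟) where
  open RawCategory 𝒟
  open IsCategory isCategory
  open ≡-Reasoning

  idˡ : ∀ {A B} {f : Hom A B} → id ∘ f ≡ f
  idˡ = identityˡ _

  idʳ : ∀ {A B} {f : Hom A B} → f ∘ id ≡ f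
  idʳ = identityʳ _

  assoc′ : ∀ {A B C D} {f : Hom A B} {g : Hom B C} {h : Hom C D} →
           (h ∘ g) ∘ f ≡ h ∘ (g ∘ f)
  assoc′ = assoc _ _ _

  assoc² : ∀ {A B C D E} {f : Hom A B} {g : Hom B C} {h : Hom C D} {i : Hom D E} →
           (i ∘ (h ∘ g)) ∘ f ≡ i ∘ (h ∘ (g ∘ f))
  assoc² = trans assoc′ (cong (_ ∘_) assoc′)

  assoc³ : ∀ {A B C D E F} {f : Hom A B} {g : Hom B C} {h : Hom C D} {i : Hom D E}
           {j : Hom E F} → (j ∘ (i ∘ (h ∘ g))) ∘ f ≡ j ∘ (i ∘ (h ∘ (g ∘ f)))
  assoc³ = trans assoc′ (cong (_ ∘_) assoc²)

  pullˡ : ∀ {A B C D} {f : Hom A B} {g : Hom B C} {h : Hom C D} {k : Hom B D} →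
          h ∘ g ≡ k → h ∘ (g ∘ f) ≡ k ∘ f
  pullˡ p = trans (sym assoc′) (cong (_∘ _) p)

  extendʳ : ∀ {A B C C' D} {f : Hom A B} {g : Hom B C} {h : Hom C D}
            {g' : Hom B C'} {h' : Hom C' D} →
            h ∘ g ≡ h' ∘ g' → h ∘ (g ∘ f) ≡ h' ∘ (g' ∘ f)
  extendʳ p = trans (pullˡ p) assoc′

  extend²ʳ : ∀ {A B C C' D D' E} {f : Hom A B} {g : Hom B C} {h : Hom C D} {i : Hom D E}
             {g' : Hom B C'} {h' : Hom C' D'} {i' : Hom D' E} →
             i ∘ (h ∘ g) ≡ i' ∘ (h' ∘ g') → i ∘ (h ∘ (g ∘ f)) ≡ i' ∘ (h' ∘ (g' ∘ f))
  extend²ʳ p = trans (sym assoc²) (trans (cong (_∘ _) p) assoc²)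

  cancelˡ : ∀ {A B C} {f : Hom A B} {g : Hom B C} {h : Hom C B} →
            h ∘ g ≡ id → h ∘ (g ∘ f) ≡ f
  cancelˡ p = trans (pullˡ p) idˡ

  split-epi-cancelʳ : ∀ {A B C} {f : Hom A B} {s : Hom B A} {x y : Hom B C} →
                      f ∘ s ≡ id → x ∘ f ≡ y ∘ f → x ≡ y
  split-epi-cancelʳ {f = f} {s} {x} {y} fs≡id p = begin
    x               ≡⟨ sym (trans (cong (x ∘_) fs≡id) idʳ) ⟩
    x ∘ (f ∘ s)     ≡⟨ extendʳ p ⟩
    y ∘ (f ∘ s)     ≡⟨ trans (cong (y ∘_) fs≡id) idʳ ⟩
    y               ∎

  split-mono-cancelˡ : ∀ {A B C} {f : Hom A B} {r : Hom B A} {x y : Hom C A} →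
                       r ∘ f ≡ id → f ∘ x ≡ f ∘ y → x ≡ y
  split-mono-cancelˡ {f = f} {r} {x} {y} rf≡id p = begin
    x               ≡⟨ sym (cancelˡ rf≡id) ⟩
    r ∘ (f ∘ x)     ≡⟨ cong (r ∘_) p ⟩
    r ∘ (f ∘ y)     ≡⟨ cancelˡ rf≡id ⟩
    y               ∎

  switch-sectionʳ : ∀ {A B C} {f : Hom B A} {s : Hom A B} {x : Hom A C} {y : Hom B C} →
                    f ∘ s ≡ id → x ∘ f ≡ y → x ≡ y ∘ s
  switch-sectionʳ {f = f} {s} {x} fs≡id p =
    trans (sym (trans (cong (x ∘_) fs≡id) idʳ)) (trans (sym assoc′) (cong (_∘ s) p))

  inverse-unique : ∀ {A B} {f : Hom A B} {g h : Hom B A} → g ∘ f ≡ id → f ∘ h ≡ id → g ≡ h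
  inverse-unique {f = f} {g} {h} gf≡id fh≡id = begin
    g               ≡⟨ sym (trans (cong (g ∘_) fh≡id) idʳ) ⟩
    g ∘ (f ∘ h)     ≡⟨ cancelˡ gf≡id ⟩
    h               ∎

module SymmetricMonoidalReasoning {o ℓ} (𝒟 : RawCategory o ℓ) (isCategory : IsCategory 𝒟)
    (M : MonoidalData 𝒟) (isSymmetricMonoidal : IsSymmetricMonoidal 𝒟 M) where
  open RawCategory 𝒟
  open MonoidalData M
  open IsSymmetricMonoidal isSymmetricMonoidal
  open CategoryReasoning 𝒟 isCategory
  open ≡-Reasoning

  α⁻¹ : ∀ A B C → Hom ((A ⊗₀ B) ⊗₀ C) (A ⊗₀ (B ⊗₀ C))
  α⁻¹ A B C = proj₁ (α-iso A B C)

  α⁻¹∘α : ∀ {A B C} → α⁻¹ A B C ∘ α A B C ≡ id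
  α⁻¹∘α {A} {B} {C} = proj₁ (proj₂ (α-iso A B C))

  α∘α⁻¹ : ∀ {A B C} → α A B C ∘ α⁻¹ A B C ≡ id
  α∘α⁻¹ {A} {B} {C} = proj₂ (proj₂ (α-iso A B C))

  σ∘σ : ∀ {A B} → σ B A ∘ σ A B ≡ id
  σ∘σ = symmetry _ _

  ⊗-∘ : ∀ {A B C A' B' C'} {f : Hom A B} {g : Hom B C} {f' : Hom A' B'} {g' : Hom B' C'} →
        (g ⊗₁ g') ∘ (f ⊗₁ f') ≡ (g ∘ f) ⊗₁ (g' ∘ f')
  ⊗-∘ = sym (⊗-homomorphism _ _ _ _)

  id⊗-∘ : ∀ {X A B C} {f : Hom A B} {g : Hom B C} → id {X} ⊗₁ (g ∘ f) ≡ (id ⊗₁ g) ∘ (id ⊗₁ f)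
  id⊗-∘ = trans (cong (_⊗₁ _) (sym idˡ)) (⊗-homomorphism _ _ _ _)

  ∘⊗id : ∀ {X A B C} {f : Hom A B} {g : Hom B C} → (g ∘ f) ⊗₁ id {X} ≡ (g ⊗₁ id) ∘ (f ⊗₁ id)
  ∘⊗id = trans (cong (_ ⊗₁_) (sym idˡ)) (⊗-homomorphism _ _ _ _)

  id⊗σ∘id⊗σ : ∀ {X A B} → (id {X} ⊗₁ σ B A) ∘ (id ⊗₁ σ A B) ≡ id
  id⊗σ∘id⊗σ = trans ⊗-∘ (trans (cong₂ _⊗₁_ idˡ σ∘σ) ⊗-identity)

  σ⊗id∘σ⊗id : ∀ {X A B} → (σ B A ⊗₁ id {X}) ∘ (σ A B ⊗₁ id) ≡ id
  σ⊗id∘σ⊗id = trans ⊗-∘ (trans (cong₂ _⊗₁_ σ∘σ idˡ) ⊗-identity)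

  unit⊗-faithful : ∀ {A B} {f g : Hom A B} → id {unit} ⊗₁ f ≡ id ⊗₁ g → f ≡ g
  unit⊗-faithful {A} {B} {f} {g} p = split-epi-cancelʳ (proj₂ (proj₂ (λ-iso A))) (begin
    f ∘ λ' A              ≡⟨ sym (λ-natural f) ⟩
    λ' B ∘ (id ⊗₁ f)      ≡⟨ cong (λ' B ∘_) p ⟩
    λ' B ∘ (id ⊗₁ g)      ≡⟨ λ-natural g ⟩
    g ∘ λ' A              ∎)

  -- Kelly's redundant axiom: both sides become equal after tensoring with the unit
  -- on the left, where the pentagon and the triangle apply.
  λ⊗id∘α : ∀ A B → (λ' A ⊗₁ id {B}) ∘ α unit A B ≡ λ' (A ⊗₀ B)
  λ⊗id∘α A B =
    sym (unit⊗-faithful (split-mono-cancelˡ α⁻¹∘α (trans via-triangle (sym via-pentagon))))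
    where
    ρ⊗id⊗id∘α∘α : Hom (unit ⊗₀ (unit ⊗₀ (A ⊗₀ B))) ((unit ⊗₀ A) ⊗₀ B)
    ρ⊗id⊗id∘α∘α = ((ρ unit ⊗₁ id) ⊗₁ id) ∘ (α (unit ⊗₀ unit) A B ∘ α unit unit (A ⊗₀ B))

    via-triangle : α unit A B ∘ (id ⊗₁ λ' (A ⊗₀ B)) ≡ ρ⊗id⊗id∘α∘α
    via-triangle = begin
      α unit A B ∘ (id ⊗₁ λ' (A ⊗₀ B))
        ≡⟨ cong (α unit A B ∘_) (sym (triangle unit (A ⊗₀ B))) ⟩
      α unit A B ∘ ((ρ unit ⊗₁ id) ∘ α unit unit (A ⊗₀ B))
        ≡⟨ cong (λ z → α unit A B ∘ ((ρ unit ⊗₁ z) ∘ α unit unit (A ⊗₀ B))) (sym ⊗-identity) ⟩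
      α unit A B ∘ ((ρ unit ⊗₁ (id ⊗₁ id)) ∘ α unit unit (A ⊗₀ B))
        ≡⟨ extendʳ (α-natural (ρ unit) id id) ⟩
      ρ⊗id⊗id∘α∘α ∎

    via-pentagon : α unit A B ∘ (id ⊗₁ ((λ' A ⊗₁ id) ∘ α unit A B)) ≡ ρ⊗id⊗id∘α∘α
    via-pentagon = begin
      α unit A B ∘ (id ⊗₁ ((λ' A ⊗₁ id) ∘ α unit A B))
        ≡⟨ cong (α unit A B ∘_) id⊗-∘ ⟩
      α unit A B ∘ ((id ⊗₁ (λ' A ⊗₁ id)) ∘ (id ⊗₁ α unit A B))
        ≡⟨ extendʳ (α-natural id (λ' A) id) ⟩
      ((id ⊗₁ λ' A) ⊗₁ id) ∘ (α unit (unit ⊗₀ A) B ∘ (id ⊗₁ α unit A B))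
        ≡⟨ cong (λ z → (z ⊗₁ id) ∘ (α unit (unit ⊗₀ A) B ∘ (id ⊗₁ α unit A B)))
             (sym (triangle unit A)) ⟩
      (((ρ unit ⊗₁ id) ∘ α unit unit A) ⊗₁ id) ∘ (α unit (unit ⊗₀ A) B ∘ (id ⊗₁ α unit A B))
        ≡⟨ cong (_∘ (α unit (unit ⊗₀ A) B ∘ (id ⊗₁ α unit A B))) ∘⊗id ⟩
      (((ρ unit ⊗₁ id) ⊗₁ id) ∘ (α unit unit A ⊗₁ id)) ∘ (α unit (unit ⊗₀ A) B ∘ (id ⊗₁ α unit A B))
        ≡⟨ trans assoc′ (cong (_ ∘_) (sym (pentagon unit unit A B))) ⟩
      ρ⊗id⊗id∘α∘α ∎

  ρ∘σ : ∀ A → ρ A ∘ σ unit A ≡ λ' A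
  ρ∘σ A = split-epi-cancelʳ (proj₂ (proj₂ (ρ-iso (unit ⊗₀ A)))) (begin
    (ρ A ∘ σ unit A) ∘ ρ (unit ⊗₀ A)      ≡⟨ sym (ρ-natural _) ⟩
    ρ A ∘ ((ρ A ∘ σ unit A) ⊗₁ id)        ≡⟨ cong (ρ A ∘_) (ρ∘σ⊗id A unit) ⟩
    ρ A ∘ (λ' A ⊗₁ id)                    ≡⟨ ρ-natural _ ⟩
    λ' A ∘ ρ (unit ⊗₀ A)                  ∎)
    where
    -- Both sides, precomposed with the isomorphism α ∘ (id ⊗ σ), reduce to σ ∘ λ:
    -- the left one by the hexagon and the triangle, the right one by Kelly's axiom.
    ρ∘σ⊗id : ∀ C B → (ρ C ∘ σ unit C) ⊗₁ id {B} ≡ λ' C ⊗₁ id {B}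
    ρ∘σ⊗id C B = split-epi-cancelʳ α∘id⊗σ-iso (trans via-hexagon (sym via-kelly))
      where
      α∘id⊗σ-iso : (α unit C B ∘ (id ⊗₁ σ B C)) ∘ ((id ⊗₁ σ C B) ∘ α⁻¹ unit C B) ≡ id
      α∘id⊗σ-iso = trans assoc′ (trans (cong (α unit C B ∘_) (cancelˡ id⊗σ∘id⊗σ)) α∘α⁻¹)

      via-hexagon : ((ρ C ∘ σ unit C) ⊗₁ id {B}) ∘ (α unit C B ∘ (id ⊗₁ σ B C))
                    ≡ σ B C ∘ λ' (B ⊗₀ C)
      via-hexagon = begin
        ((ρ C ∘ σ unit C) ⊗₁ id) ∘ (α unit C B ∘ (id ⊗₁ σ B C))
          ≡⟨ trans (cong (_∘ (α unit C B ∘ (id ⊗₁ σ B C))) ∘⊗id) assoc′ ⟩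
        (ρ C ⊗₁ id) ∘ ((σ unit C ⊗₁ id) ∘ (α unit C B ∘ (id ⊗₁ σ B C)))
          ≡⟨ cong ((ρ C ⊗₁ id) ∘_) (sym (hexagon unit B C)) ⟩
        (ρ C ⊗₁ id) ∘ (α C unit B ∘ (σ (unit ⊗₀ B) C ∘ α unit B C))
          ≡⟨ pullˡ (triangle C B) ⟩
        (id ⊗₁ λ' B) ∘ (σ (unit ⊗₀ B) C ∘ α unit B C)
          ≡⟨ extendʳ (sym (σ-natural (λ' B) id)) ⟩
        σ B C ∘ ((λ' B ⊗₁ id) ∘ α unit B C)
          ≡⟨ cong (σ B C ∘_) (λ⊗id∘α B C) ⟩
        σ B C ∘ λ' (B ⊗₀ C) ∎

      via-kelly : (λ' C ⊗₁ id {B}) ∘ (α unit C B ∘ (id ⊗₁ σ B C)) ≡ σ B C ∘ λ' (B ⊗₀ C)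
      via-kelly = trans (pullˡ (λ⊗id∘α C B)) (λ-natural (σ B C))

  λ∘σ : ∀ A → λ' A ∘ σ A unit ≡ ρ A
  λ∘σ A = begin
    λ' A ∘ σ A unit                  ≡⟨ cong (_∘ σ A unit) (sym (ρ∘σ A)) ⟩
    (ρ A ∘ σ unit A) ∘ σ A unit      ≡⟨ trans assoc′ (cong (ρ A ∘_) σ∘σ) ⟩
    ρ A ∘ id                         ≡⟨ idʳ ⟩
    ρ A                              ∎

  exchange-coherence : ∀ A B C →
    σ C (A ⊗₀ B) ∘ (α⁻¹ C A B ∘ (σ A C ⊗₁ id {B})) ≡ α A B C ∘ ((id ⊗₁ σ C B) ∘ α⁻¹ A C B)
  exchange-coherence A B C = trans (switch-sectionʳ α∘α⁻¹ after-α) assoc′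
    where
    after-α : (σ C (A ⊗₀ B) ∘ (α⁻¹ C A B ∘ (σ A C ⊗₁ id {B}))) ∘ α A C B
              ≡ α A B C ∘ (id ⊗₁ σ C B)
    after-α = begin
      (σ C (A ⊗₀ B) ∘ (α⁻¹ C A B ∘ (σ A C ⊗₁ id))) ∘ α A C B
        ≡⟨ assoc² ⟩
      σ C (A ⊗₀ B) ∘ (α⁻¹ C A B ∘ ((σ A C ⊗₁ id) ∘ α A C B))
        ≡⟨ cong (λ z → σ C (A ⊗₀ B) ∘ (α⁻¹ C A B ∘ ((σ A C ⊗₁ id) ∘ z)))
             (sym (trans (cong (α A C B ∘_) id⊗σ∘id⊗σ) idʳ)) ⟩
      σ C (A ⊗₀ B) ∘ (α⁻¹ C A B ∘ ((σ A C ⊗₁ id) ∘ (α A C B ∘ ((id ⊗₁ σ B C) ∘ (id ⊗₁ σ C B)))))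
        ≡⟨ cong (λ z → σ C (A ⊗₀ B) ∘ (α⁻¹ C A B ∘ z)) (extend²ʳ (sym (hexagon A B C))) ⟩
      σ C (A ⊗₀ B) ∘ (α⁻¹ C A B ∘ (α C A B ∘ (σ (A ⊗₀ B) C ∘ (α A B C ∘ (id ⊗₁ σ C B)))))
        ≡⟨ cong (σ C (A ⊗₀ B) ∘_) (cancelˡ α⁻¹∘α) ⟩
      σ C (A ⊗₀ B) ∘ (σ (A ⊗₀ B) C ∘ (α A B C ∘ (id ⊗₁ σ C B)))
        ≡⟨ cancelˡ σ∘σ ⟩
      α A B C ∘ (id ⊗₁ σ C B) ∎

  -- The second hexagon: the inverse of each side of hexagon B C A is computed by
  -- inverting its factors, and inverses are unique.
  hexagon₂ : ∀ A B C →
    σ A (B ⊗₀ C) ≡ α B C A ∘ ((id ⊗₁ σ A C) ∘ (α⁻¹ B A C ∘ ((σ A B ⊗₁ id) ∘ α A B C)))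
  hexagon₂ A B C = begin
    σ A (B ⊗₀ C)
      ≡⟨ sym (cancelˡ α∘α⁻¹) ⟩
    α B C A ∘ (α⁻¹ B C A ∘ σ A (B ⊗₀ C))
      ≡⟨ cong (λ z → α B C A ∘ (α⁻¹ B C A ∘ z)) (sym (trans (cong (σ A (B ⊗₀ C) ∘_) α⁻¹∘α) idʳ)) ⟩
    α B C A ∘ (α⁻¹ B C A ∘ (σ A (B ⊗₀ C) ∘ (α⁻¹ A B C ∘ α A B C)))
      ≡⟨ cong (α B C A ∘_) (sym assoc²) ⟩
    α B C A ∘ ((α⁻¹ B C A ∘ (σ A (B ⊗₀ C) ∘ α⁻¹ A B C)) ∘ α A B C)
      ≡⟨ cong (λ z → α B C A ∘ (z ∘ α A B C)) inverses ⟩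
    α B C A ∘ (((id ⊗₁ σ A C) ∘ (α⁻¹ B A C ∘ (σ A B ⊗₁ id))) ∘ α A B C)
      ≡⟨ cong (α B C A ∘_) assoc² ⟩
    α B C A ∘ ((id ⊗₁ σ A C) ∘ (α⁻¹ B A C ∘ ((σ A B ⊗₁ id) ∘ α A B C))) ∎
    where
    left-inverse : (α⁻¹ B C A ∘ (σ A (B ⊗₀ C) ∘ α⁻¹ A B C)) ∘ (α A B C ∘ (σ (B ⊗₀ C) A ∘ α B C A))
                   ≡ id
    left-inverse = trans assoc² (trans (cong (λ z → α⁻¹ B C A ∘ (σ A (B ⊗₀ C) ∘ z)) (cancelˡ α⁻¹∘α))
                     (trans (cong (α⁻¹ B C A ∘_) (cancelˡ σ∘σ)) α⁻¹∘α))

    right-inverse : ((σ B A ⊗₁ id {C}) ∘ (α B A C ∘ (id ⊗₁ σ C A)))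
                    ∘ ((id ⊗₁ σ A C) ∘ (α⁻¹ B A C ∘ (σ A B ⊗₁ id))) ≡ id
    right-inverse = trans assoc² (trans (cong (λ z → (σ B A ⊗₁ id) ∘ (α B A C ∘ z)) (cancelˡ id⊗σ∘id⊗σ))
                      (trans (cong ((σ B A ⊗₁ id) ∘_) (cancelˡ α∘α⁻¹)) σ⊗id∘σ⊗id))

    inverses : α⁻¹ B C A ∘ (σ A (B ⊗₀ C) ∘ α⁻¹ A B C) ≡ (id ⊗₁ σ A C) ∘ (α⁻¹ B A C ∘ (σ A B ⊗₁ id))
    inverses = inverse-unique left-inverse
                 (trans (cong (_∘ ((id ⊗₁ σ A C) ∘ (α⁻¹ B A C ∘ (σ A B ⊗₁ id)))) (hexagon B C A))
                        right-inverse)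

  reversal-coherence : ∀ A B C →
    α C B A ∘ ((id ⊗₁ σ A B) ∘ (σ (A ⊗₀ B) C ∘ α A B C)) ≡ (σ B C ⊗₁ id {A}) ∘ σ A (B ⊗₀ C)
  reversal-coherence A B C = begin
    α C B A ∘ ((id ⊗₁ σ A B) ∘ (σ (A ⊗₀ B) C ∘ α A B C))
      ≡⟨ cong (α C B A ∘_) (extendʳ (sym (σ-natural (σ A B) id))) ⟩
    α C B A ∘ (σ (B ⊗₀ A) C ∘ ((σ A B ⊗₁ id) ∘ α A B C))
      ≡⟨ sym assoc′ ⟩
    (α C B A ∘ σ (B ⊗₀ A) C) ∘ ((σ A B ⊗₁ id) ∘ α A B C)
      ≡⟨ cong (_∘ ((σ A B ⊗₁ id) ∘ α A B C)) hexagon-B-A-C ⟩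
    ((σ B C ⊗₁ id) ∘ (α B C A ∘ ((id ⊗₁ σ A C) ∘ α⁻¹ B A C))) ∘ ((σ A B ⊗₁ id) ∘ α A B C)
      ≡⟨ assoc³ ⟩
    (σ B C ⊗₁ id) ∘ (α B C A ∘ ((id ⊗₁ σ A C) ∘ (α⁻¹ B A C ∘ ((σ A B ⊗₁ id) ∘ α A B C))))
      ≡⟨ cong ((σ B C ⊗₁ id) ∘_) (sym (hexagon₂ A B C)) ⟩
    (σ B C ⊗₁ id) ∘ σ A (B ⊗₀ C) ∎
    where
    hexagon-B-A-C : α C B A ∘ σ (B ⊗₀ A) C ≡ (σ B C ⊗₁ id) ∘ (α B C A ∘ ((id ⊗₁ σ A C) ∘ α⁻¹ B A C))
    hexagon-B-A-C = trans (switch-sectionʳ α∘α⁻¹ (trans assoc′ (hexagon B A C)))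
                      (trans assoc′ (cong ((σ B C ⊗₁ id) ∘_) assoc′))

  rotation-coherence : ∀ A B C →
    σ C (A ⊗₀ B) ∘ ((id ⊗₁ σ B A) ∘ (α⁻¹ C B A ∘ (σ B C ⊗₁ id {A}))) ≡ α A B C ∘ σ (B ⊗₀ C) A
  rotation-coherence A B C = begin
    σ C (A ⊗₀ B) ∘ ((id ⊗₁ σ B A) ∘ (α⁻¹ C B A ∘ (σ B C ⊗₁ id)))
      ≡⟨ sym (cancelˡ α∘α⁻¹) ⟩
    α A B C ∘ (α⁻¹ A B C ∘ (σ C (A ⊗₀ B) ∘ ((id ⊗₁ σ B A) ∘ (α⁻¹ C B A ∘ (σ B C ⊗₁ id)))))
      ≡⟨ cong (α A B C ∘_) (sym assoc³) ⟩
    α A B C ∘ ((α⁻¹ A B C ∘ (σ C (A ⊗₀ B) ∘ ((id ⊗₁ σ B A) ∘ α⁻¹ C B A))) ∘ (σ B C ⊗₁ id))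
      ≡⟨ cong (λ z → α A B C ∘ (z ∘ (σ B C ⊗₁ id))) inverses ⟩
    α A B C ∘ ((σ (B ⊗₀ C) A ∘ (σ C B ⊗₁ id)) ∘ (σ B C ⊗₁ id))
      ≡⟨ cong (α A B C ∘_) (trans assoc′ (trans (cong (σ (B ⊗₀ C) A ∘_) σ⊗id∘σ⊗id) idʳ)) ⟩
    α A B C ∘ σ (B ⊗₀ C) A ∎
    where
    left-inverse : (α⁻¹ A B C ∘ (σ C (A ⊗₀ B) ∘ ((id ⊗₁ σ B A) ∘ α⁻¹ C B A)))
                   ∘ (α C B A ∘ ((id ⊗₁ σ A B) ∘ (σ (A ⊗₀ B) C ∘ α A B C))) ≡ id
    left-inverse =
      trans assoc³ (trans (cong (λ z → α⁻¹ A B C ∘ (σ C (A ⊗₀ B) ∘ ((id ⊗₁ σ B A) ∘ z))) (cancelˡ α⁻¹∘α))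
        (trans (cong (λ z → α⁻¹ A B C ∘ (σ C (A ⊗₀ B) ∘ z)) (cancelˡ id⊗σ∘id⊗σ))
        (trans (cong (α⁻¹ A B C ∘_) (cancelˡ σ∘σ)) α⁻¹∘α)))

    right-inverse : ((σ B C ⊗₁ id {A}) ∘ σ A (B ⊗₀ C)) ∘ (σ (B ⊗₀ C) A ∘ (σ C B ⊗₁ id)) ≡ id
    right-inverse = trans assoc′ (trans (cong ((σ B C ⊗₁ id) ∘_) (cancelˡ σ∘σ)) σ⊗id∘σ⊗id)

    inverses : α⁻¹ A B C ∘ (σ C (A ⊗₀ B) ∘ ((id ⊗₁ σ B A) ∘ α⁻¹ C B A)) ≡ σ (B ⊗₀ C) A ∘ (σ C B ⊗₁ id)
    inverses = inverse-unique left-inverse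
                 (trans (cong (_∘ (σ (B ⊗₀ C) A ∘ (σ C B ⊗₁ id))) (reversal-coherence A B C))
                        right-inverse)

module KleisliSymmetricMonoidalDagger {o ℓ} (𝒞 : SymmetricMonoidalDaggerCategory o ℓ)
    (𝕋 : Monad 𝒞)
    (st : ∀ A B → SymmetricMonoidalDaggerCategory.Hom 𝒞
            (SymmetricMonoidalDaggerCategory._⊗₀_ 𝒞 A (Monad.T₀ 𝕋 B))
            (Monad.T₀ 𝕋 (SymmetricMonoidalDaggerCategory._⊗₀_ 𝒞 A B)))
    (isCommutativeStrongFrobenius : Strength.IsCommutativeStrongFrobenius 𝒞 𝕋 st) where
  open SymmetricMonoidalDaggerCategory 𝒞
  open IsSymmetricMonoidalDagger isSMD
  open IsCategory isCategory
  open IsDagger isDagger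
  open IsSymmetricMonoidal isSymmetricMonoidal
  open Monad 𝕋
  open Strength 𝒞 𝕋 st
  open IsCommutativeStrongFrobenius isCommutativeStrongFrobenius
  open IsFrobenius isFrobenius
  open IsStrong isStrong
  open CategoryReasoning raw isCategory
  open SymmetricMonoidalReasoning raw isCategory monoidal isSymmetricMonoidal
  open ≡-Reasoning

  infixr 9 _∙_
  _∙_ : ∀ {A B C} → Hom B (T₀ C) → Hom A (T₀ B) → Hom A (T₀ C)
  g ∙ f = μ _ ∘ (T₁ g ∘ f)

  T₁-∘ : ∀ {A B C} {f : Hom A B} {g : Hom B C} → T₁ g ∘ T₁ f ≡ T₁ (g ∘ f)
  T₁-∘ = sym (T-homomorphism _ _)

  T-homomorphism² : ∀ {A B C D} {f : Hom A B} {g : Hom B C} {h : Hom C D} →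
                    T₁ (h ∘ (g ∘ f)) ≡ T₁ h ∘ (T₁ g ∘ T₁ f)
  T-homomorphism² = trans (T-homomorphism _ _) (cong (_ ∘_) (T-homomorphism _ _))

  ∙-identityˡ : ∀ {A B} (f : Hom A (T₀ B)) → η B ∙ f ≡ f
  ∙-identityˡ f = cancelˡ (μ-unitˡ _)

  ∙-identityʳ : ∀ {A B} (f : Hom A (T₀ B)) → f ∙ η A ≡ f
  ∙-identityʳ f = trans (cong (μ _ ∘_) (sym (η-natural f))) (cancelˡ (μ-unitʳ _))

  ∙-assoc : ∀ {A B C D} (f : Hom A (T₀ B)) (g : Hom B (T₀ C)) (h : Hom C (T₀ D)) →
            (h ∙ g) ∙ f ≡ h ∙ (g ∙ f)
  ∙-assoc f g h = begin
    μ _ ∘ (T₁ (μ _ ∘ (T₁ h ∘ g)) ∘ f)          ≡⟨ cong (λ z → μ _ ∘ (z ∘ f)) T-homomorphism² ⟩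
    μ _ ∘ ((T₁ (μ _) ∘ (T₁ (T₁ h) ∘ T₁ g)) ∘ f) ≡⟨ cong (μ _ ∘_) assoc² ⟩
    μ _ ∘ (T₁ (μ _) ∘ (T₁ (T₁ h) ∘ (T₁ g ∘ f))) ≡⟨ extendʳ (μ-assoc _) ⟩
    μ _ ∘ (μ _ ∘ (T₁ (T₁ h) ∘ (T₁ g ∘ f)))      ≡⟨ cong (μ _ ∘_) (extendʳ (μ-natural h)) ⟩
    μ _ ∘ (T₁ h ∘ (μ _ ∘ (T₁ g ∘ f)))           ∎

  kleisli-isCategory : IsCategory kleisli
  kleisli-isCategory = record
    { assoc = ∙-assoc ; identityˡ = ∙-identityˡ ; identityʳ = ∙-identityʳ }

  module K = CategoryReasoning kleisli kleisli-isCategory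

  J∙≡T₁∘ : ∀ {A B C} (h : Hom B C) (k : Hom A (T₀ B)) → J h ∙ k ≡ T₁ h ∘ k
  J∙≡T₁∘ h k = begin
    μ _ ∘ (T₁ (η _ ∘ h) ∘ k)            ≡⟨ cong (λ z → μ _ ∘ (z ∘ k)) (T-homomorphism h (η _)) ⟩
    μ _ ∘ ((T₁ (η _) ∘ T₁ h) ∘ k)       ≡⟨ cong (μ _ ∘_) assoc′ ⟩
    μ _ ∘ (T₁ (η _) ∘ (T₁ h ∘ k))       ≡⟨ cancelˡ (μ-unitˡ _) ⟩
    T₁ h ∘ k                            ∎

  ∙J≡∘ : ∀ {A B C} (k : Hom B (T₀ C)) (h : Hom A B) → k ∙ J h ≡ k ∘ h
  ∙J≡∘ k h = trans (cong (μ _ ∘_) (extendʳ (sym (η-natural k)))) (cancelˡ (μ-unitʳ _))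

  J-homomorphism : ∀ {A B C} {f : Hom A B} {g : Hom B C} → J g ∙ J f ≡ J (g ∘ f)
  J-homomorphism {f = f} {g} = trans (J∙≡T₁∘ g (J f)) (trans (pullˡ (sym (η-natural g))) assoc′)

  J-identity : ∀ {A} → J (id {A}) ≡ η A
  J-identity = idʳ

  J-inverse : ∀ {A B} {f : Hom A B} {g : Hom B A} → g ∘ f ≡ id → J g ∙ J f ≡ η A
  J-inverse gf≡id = trans J-homomorphism (trans (cong J gf≡id) J-identity)

  J-preserves-iso : ∀ {A B} {f : Hom A B} → IsIso raw f → IsIso kleisli (J f)
  J-preserves-iso (g , gf≡id , fg≡id) = J g , J-inverse gf≡id , J-inverse fg≡id

  J-symmetry : ∀ {A B} → J (σ B A) ∙ J (σ A B) ≡ η _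
  J-symmetry = J-inverse σ∘σ

  infixr 10 _⊗ˡ_
  _⊗ˡ_ : ∀ X {B C} → Hom B (T₀ C) → Hom (X ⊗₀ B) (T₀ (X ⊗₀ C))
  X ⊗ˡ k = st X _ ∘ (id ⊗₁ k)

  infixl 10 _⊗ʳ_
  _⊗ʳ_ : ∀ {A B} → Hom A (T₀ B) → ∀ Y → Hom (A ⊗₀ Y) (T₀ (B ⊗₀ Y))
  k ⊗ʳ Y = st' _ Y ∘ (k ⊗₁ id)

  ⊗ˡ-η : ∀ X {B} → X ⊗ˡ η B ≡ η (X ⊗₀ B)
  ⊗ˡ-η X = st-η X _

  ⊗ˡ-∙ : ∀ X {A B C} (g : Hom B (T₀ C)) (f : Hom A (T₀ B)) → X ⊗ˡ (g ∙ f) ≡ X ⊗ˡ g ∙ X ⊗ˡ f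
  ⊗ˡ-∙ X g f = begin
    st _ _ ∘ (id ⊗₁ (μ _ ∘ (T₁ g ∘ f)))
      ≡⟨ cong (st _ _ ∘_) (trans id⊗-∘ (cong ((id ⊗₁ μ _) ∘_) id⊗-∘)) ⟩
    st _ _ ∘ ((id ⊗₁ μ _) ∘ ((id ⊗₁ T₁ g) ∘ (id ⊗₁ f)))
      ≡⟨ trans (pullˡ (st-μ _ _)) assoc² ⟩
    μ _ ∘ (T₁ (st _ _) ∘ (st _ _ ∘ ((id ⊗₁ T₁ g) ∘ (id ⊗₁ f))))
      ≡⟨ cong (λ z → μ _ ∘ (T₁ (st _ _) ∘ z)) (extendʳ (st-natural id g)) ⟩
    μ _ ∘ (T₁ (st _ _) ∘ (T₁ (id ⊗₁ g) ∘ (st _ _ ∘ (id ⊗₁ f))))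
      ≡⟨ cong (μ _ ∘_) (pullˡ T₁-∘) ⟩
    X ⊗ˡ g ∙ X ⊗ˡ f ∎

  ⊗ˡ-J : ∀ X {A B} (h : Hom A B) → X ⊗ˡ J h ≡ J (id {X} ⊗₁ h)
  ⊗ˡ-J X h = trans (cong (st _ _ ∘_) id⊗-∘) (pullˡ (st-η _ _))

  ⊗ˡ-natural : ∀ {X X' A B} (p : Hom X X') (k : Hom A (T₀ B)) →
               X' ⊗ˡ k ∙ J (p ⊗₁ id) ≡ J (p ⊗₁ id) ∙ X ⊗ˡ k
  ⊗ˡ-natural {X} {X'} p k = begin
    X' ⊗ˡ k ∙ J (p ⊗₁ id)                ≡⟨ trans (∙J≡∘ _ _) assoc′ ⟩
    st _ _ ∘ ((id ⊗₁ k) ∘ (p ⊗₁ id))     ≡⟨ cong (st _ _ ∘_) interchange ⟩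
    st _ _ ∘ ((p ⊗₁ T₁ id) ∘ (id ⊗₁ k))  ≡⟨ extendʳ (st-natural p id) ⟩
    T₁ (p ⊗₁ id) ∘ (st _ _ ∘ (id ⊗₁ k))  ≡⟨ sym (J∙≡T₁∘ _ _) ⟩
    J (p ⊗₁ id) ∙ X ⊗ˡ k                 ∎
    where
    interchange : (id ⊗₁ k) ∘ (p ⊗₁ id) ≡ (p ⊗₁ T₁ id) ∘ (id ⊗₁ k)
    interchange = trans ⊗-∘ (trans (cong₂ _⊗₁_ (trans idˡ (sym idʳ))
                    (trans idʳ (trans (sym idˡ) (cong (_∘ k) (sym T-identity))))) (sym ⊗-∘))

  α-⊗ˡ-⊗ˡ : ∀ X Y {Z Z'} (k : Hom Z (T₀ Z')) →
            J (α X Y Z') ∙ X ⊗ˡ (Y ⊗ˡ k) ≡ (X ⊗₀ Y) ⊗ˡ k ∙ J (α X Y Z)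
  α-⊗ˡ-⊗ˡ X Y k = begin
    J (α _ _ _) ∙ X ⊗ˡ (Y ⊗ˡ k)
      ≡⟨ J∙≡T₁∘ _ _ ⟩
    T₁ (α _ _ _) ∘ (st _ _ ∘ (id ⊗₁ (st _ _ ∘ (id ⊗₁ k))))
      ≡⟨ cong (λ z → T₁ (α _ _ _) ∘ (st _ _ ∘ z)) id⊗-∘ ⟩
    T₁ (α _ _ _) ∘ (st _ _ ∘ ((id ⊗₁ st _ _) ∘ (id ⊗₁ (id ⊗₁ k))))
      ≡⟨ trans (sym assoc²) (trans (cong (_∘ (id ⊗₁ (id ⊗₁ k))) (sym (st-α _ _ _))) assoc′) ⟩
    st _ _ ∘ (α _ _ _ ∘ (id ⊗₁ (id ⊗₁ k)))
      ≡⟨ cong (st _ _ ∘_) (trans (α-natural id id k) (cong (λ z → (z ⊗₁ k) ∘ α _ _ _) ⊗-identity)) ⟩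
    st _ _ ∘ ((id ⊗₁ k) ∘ α _ _ _)
      ≡⟨ trans (sym assoc′) (sym (∙J≡∘ _ _)) ⟩
    (X ⊗₀ Y) ⊗ˡ k ∙ J (α X Y _) ∎

  λ-⊗ˡ : ∀ {A B} (k : Hom A (T₀ B)) → J (λ' B) ∙ unit ⊗ˡ k ≡ k ∙ J (λ' A)
  λ-⊗ˡ k = begin
    J (λ' _) ∙ unit ⊗ˡ k                    ≡⟨ J∙≡T₁∘ _ _ ⟩
    T₁ (λ' _) ∘ (st _ _ ∘ (id ⊗₁ k))        ≡⟨ pullˡ (st-λ _) ⟩
    λ' _ ∘ (id ⊗₁ k)                        ≡⟨ λ-natural k ⟩
    k ∘ λ' _                                ≡⟨ sym (∙J≡∘ _ _) ⟩
    k ∙ J (λ' _)                            ∎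

  st'-natural : ∀ {A B A' B'} (f : Hom A A') (g : Hom B B') →
                st' A' B' ∘ (T₁ f ⊗₁ g) ≡ T₁ (f ⊗₁ g) ∘ st' A B
  st'-natural f g = begin
    (T₁ (σ _ _) ∘ (st _ _ ∘ σ _ _)) ∘ (T₁ f ⊗₁ g)
      ≡⟨ assoc² ⟩
    T₁ (σ _ _) ∘ (st _ _ ∘ (σ _ _ ∘ (T₁ f ⊗₁ g)))
      ≡⟨ cong (λ z → T₁ (σ _ _) ∘ (st _ _ ∘ z)) (σ-natural _ _) ⟩
    T₁ (σ _ _) ∘ (st _ _ ∘ ((g ⊗₁ T₁ f) ∘ σ _ _))
      ≡⟨ cong (T₁ (σ _ _) ∘_) (extendʳ (st-natural g f)) ⟩
    T₁ (σ _ _) ∘ (T₁ (g ⊗₁ f) ∘ (st _ _ ∘ σ _ _))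
      ≡⟨ extendʳ (trans T₁-∘ (trans (cong T₁ (σ-natural g f)) (T-homomorphism _ _))) ⟩
    T₁ (f ⊗₁ g) ∘ (T₁ (σ _ _) ∘ (st _ _ ∘ σ _ _)) ∎

  ⊗ʳ-conjugate : ∀ Y {A B} (k : Hom A (T₀ B)) → k ⊗ʳ Y ≡ J (σ Y B) ∙ Y ⊗ˡ k ∙ J (σ A Y)
  ⊗ʳ-conjugate Y k = begin
    (T₁ (σ _ _) ∘ (st _ _ ∘ σ _ _)) ∘ (k ⊗₁ id)
      ≡⟨ assoc² ⟩
    T₁ (σ _ _) ∘ (st _ _ ∘ (σ _ _ ∘ (k ⊗₁ id)))
      ≡⟨ cong (λ z → T₁ (σ _ _) ∘ (st _ _ ∘ z)) (σ-natural k id) ⟩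
    T₁ (σ _ _) ∘ (st _ _ ∘ ((id ⊗₁ k) ∘ σ _ _))
      ≡⟨ cong (T₁ (σ _ _) ∘_) (sym assoc′) ⟩
    T₁ (σ _ _) ∘ (Y ⊗ˡ k ∘ σ _ _)
      ≡⟨ sym (trans (J∙≡T₁∘ _ _) (cong (T₁ (σ _ _) ∘_) (∙J≡∘ _ _))) ⟩
    J (σ Y _) ∙ Y ⊗ˡ k ∙ J (σ _ Y) ∎

  ⊗ʳ-η : ∀ Y {A} → η A ⊗ʳ Y ≡ η (A ⊗₀ Y)
  ⊗ʳ-η Y = begin
    η _ ⊗ʳ Y                              ≡⟨ ⊗ʳ-conjugate Y _ ⟩
    J (σ _ _) ∙ Y ⊗ˡ η _ ∙ J (σ _ _)      ≡⟨ cong (λ z → J (σ _ _) ∙ z ∙ J (σ _ _)) (⊗ˡ-η Y) ⟩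
    J (σ _ _) ∙ η _ ∙ J (σ _ _)           ≡⟨ cong (J (σ _ _) ∙_) (∙-identityˡ _) ⟩
    J (σ _ _) ∙ J (σ _ _)                 ≡⟨ J-symmetry ⟩
    η _                                   ∎

  ⊗ʳ-∙ : ∀ Y {A B C} (g : Hom B (T₀ C)) (f : Hom A (T₀ B)) → (g ∙ f) ⊗ʳ Y ≡ g ⊗ʳ Y ∙ f ⊗ʳ Y
  ⊗ʳ-∙ Y g f = begin
    (g ∙ f) ⊗ʳ Y
      ≡⟨ ⊗ʳ-conjugate Y _ ⟩
    J (σ _ _) ∙ Y ⊗ˡ (g ∙ f) ∙ J (σ _ _)
      ≡⟨ cong (λ z → J (σ _ _) ∙ z ∙ J (σ _ _)) (⊗ˡ-∙ Y g f) ⟩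
    J (σ _ _) ∙ (Y ⊗ˡ g ∙ Y ⊗ˡ f) ∙ J (σ _ _)
      ≡⟨ cong (J (σ _ _) ∙_) (∙-assoc _ _ _) ⟩
    J (σ _ _) ∙ Y ⊗ˡ g ∙ Y ⊗ˡ f ∙ J (σ _ _)
      ≡⟨ cong (λ z → J (σ _ _) ∙ Y ⊗ˡ g ∙ z) (sym (K.cancelˡ J-symmetry)) ⟩
    J (σ _ _) ∙ Y ⊗ˡ g ∙ J (σ _ _) ∙ J (σ _ _) ∙ Y ⊗ˡ f ∙ J (σ _ _)
      ≡⟨ trans (cong (J (σ _ _) ∙_) (sym (∙-assoc _ _ _))) (sym (∙-assoc _ _ _)) ⟩
    (J (σ _ _) ∙ Y ⊗ˡ g ∙ J (σ _ _)) ∙ (J (σ _ _) ∙ Y ⊗ˡ f ∙ J (σ _ _))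
      ≡⟨ sym (cong₂ _∙_ (⊗ʳ-conjugate Y g) (⊗ʳ-conjugate Y f)) ⟩
    g ⊗ʳ Y ∙ f ⊗ʳ Y ∎

  σ-⊗ʳ : ∀ Y {A B} (f : Hom A (T₀ B)) → J (σ B Y) ∙ f ⊗ʳ Y ≡ Y ⊗ˡ f ∙ J (σ A Y)
  σ-⊗ʳ Y f = trans (cong (J (σ _ Y) ∙_) (⊗ʳ-conjugate Y f)) (K.cancelˡ J-symmetry)

  σ-⊗ˡ : ∀ X {A B} (g : Hom A (T₀ B)) → J (σ X B) ∙ X ⊗ˡ g ≡ g ⊗ʳ X ∙ J (σ X A)
  σ-⊗ˡ X g = sym (begin
    g ⊗ʳ X ∙ J (σ X _)
      ≡⟨ cong (_∙ J (σ X _)) (⊗ʳ-conjugate X g) ⟩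
    (J (σ X _) ∙ X ⊗ˡ g ∙ J (σ _ X)) ∙ J (σ X _)
      ≡⟨ trans (∙-assoc _ _ _) (cong (J (σ X _) ∙_) (∙-assoc _ _ _)) ⟩
    J (σ X _) ∙ X ⊗ˡ g ∙ J (σ _ X) ∙ J (σ X _)
      ≡⟨ cong (λ z → J (σ X _) ∙ X ⊗ˡ g ∙ z) J-symmetry ⟩
    J (σ X _) ∙ X ⊗ˡ g ∙ η _
      ≡⟨ cong (J (σ X _) ∙_) (∙-identityʳ _) ⟩
    J (σ X _) ∙ X ⊗ˡ g ∎)

  infixr 10 _⊗ₖ_
  _⊗ₖ_ : ∀ {A B A' B'} → Hom A (T₀ B) → Hom A' (T₀ B') → Hom (A ⊗₀ A') (T₀ (B ⊗₀ B'))
  f ⊗ₖ g = dst _ _ ∘ (f ⊗₁ g)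

  ⊗ₖ≡⊗ʳ∙⊗ˡ : ∀ {A B A' B'} (f : Hom A (T₀ B)) (g : Hom A' (T₀ B')) → f ⊗ₖ g ≡ f ⊗ʳ B' ∙ A ⊗ˡ g
  ⊗ₖ≡⊗ʳ∙⊗ˡ f g = begin
    (μ _ ∘ (T₁ (st' _ _) ∘ st _ _)) ∘ (f ⊗₁ g)
      ≡⟨ assoc² ⟩
    μ _ ∘ (T₁ (st' _ _) ∘ (st _ _ ∘ (f ⊗₁ g)))
      ≡⟨ cong (λ z → μ _ ∘ (T₁ (st' _ _) ∘ (st _ _ ∘ z))) split ⟩
    μ _ ∘ (T₁ (st' _ _) ∘ (st _ _ ∘ ((f ⊗₁ T₁ id) ∘ (id ⊗₁ g))))
      ≡⟨ cong (λ z → μ _ ∘ (T₁ (st' _ _) ∘ z)) (extendʳ (st-natural f id)) ⟩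
    μ _ ∘ (T₁ (st' _ _) ∘ (T₁ (f ⊗₁ id) ∘ (st _ _ ∘ (id ⊗₁ g))))
      ≡⟨ cong (μ _ ∘_) (pullˡ T₁-∘) ⟩
    f ⊗ʳ _ ∙ _ ⊗ˡ g ∎
    where
    split : f ⊗₁ g ≡ (f ⊗₁ T₁ id) ∘ (id ⊗₁ g)
    split = trans (cong₂ _⊗₁_ (sym idʳ) (trans (sym idˡ) (cong (_∘ g) (sym T-identity))))
                  (⊗-homomorphism _ _ _ _)

  dst'∘⊗≡⊗ˡ∙⊗ʳ : ∀ {A B A' B'} (f : Hom A (T₀ B)) (g : Hom A' (T₀ B')) →
                 dst' B B' ∘ (f ⊗₁ g) ≡ B ⊗ˡ g ∙ f ⊗ʳ A'
  dst'∘⊗≡⊗ˡ∙⊗ʳ f g = begin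
    (μ _ ∘ (T₁ (st _ _) ∘ st' _ _)) ∘ (f ⊗₁ g)
      ≡⟨ assoc² ⟩
    μ _ ∘ (T₁ (st _ _) ∘ (st' _ _ ∘ (f ⊗₁ g)))
      ≡⟨ cong (λ z → μ _ ∘ (T₁ (st _ _) ∘ (st' _ _ ∘ z))) split ⟩
    μ _ ∘ (T₁ (st _ _) ∘ (st' _ _ ∘ ((T₁ id ⊗₁ g) ∘ (f ⊗₁ id))))
      ≡⟨ cong (λ z → μ _ ∘ (T₁ (st _ _) ∘ z)) (extendʳ (st'-natural id g)) ⟩
    μ _ ∘ (T₁ (st _ _) ∘ (T₁ (id ⊗₁ g) ∘ (st' _ _ ∘ (f ⊗₁ id))))
      ≡⟨ cong (μ _ ∘_) (pullˡ T₁-∘) ⟩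
    _ ⊗ˡ g ∙ f ⊗ʳ _ ∎
    where
    split : f ⊗₁ g ≡ (T₁ id ⊗₁ g) ∘ (f ⊗₁ id)
    split = trans (cong₂ _⊗₁_ (trans (sym idˡ) (cong (_∘ f) (sym T-identity))) (sym idʳ))
                  (⊗-homomorphism _ _ _ _)

  -- This is the only place where commutativity of the monad is used.
  ⊗ʳ-⊗ˡ-interchange : ∀ {A B A' B'} (f : Hom A (T₀ B)) (g : Hom A' (T₀ B')) →
                      f ⊗ʳ B' ∙ A ⊗ˡ g ≡ B ⊗ˡ g ∙ f ⊗ʳ A'
  ⊗ʳ-⊗ˡ-interchange f g =
    trans (sym (⊗ₖ≡⊗ʳ∙⊗ˡ f g)) (trans (cong (_∘ (f ⊗₁ g)) (commutative _ _)) (dst'∘⊗≡⊗ˡ∙⊗ʳ f g))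

  -- The associativity naturality below is proved by bringing both sides to the form
  -- J a ∙ M ∙ J b, with M a single whiskered map and a, b built from coherence maps.
  sandwich : ∀ {A A' B B'} → Hom A' B' → Hom A (T₀ A') → Hom B A → Hom B (T₀ B')
  sandwich a M b = J a ∙ M ∙ J b

  J∙sandwich : ∀ {A A' B B' C} (c : Hom B' C) (a : Hom A' B') (M : Hom A (T₀ A')) (b : Hom B A) →
               J c ∙ sandwich a M b ≡ sandwich (c ∘ a) M b
  J∙sandwich c a M b = K.pullˡ J-homomorphism

  sandwich∙J : ∀ {A A' B B' D} (a : Hom A' B') (M : Hom A (T₀ A')) (b : Hom B A) (d : Hom D B) →
               sandwich a M b ∙ J d ≡ sandwich a M (b ∘ d)
  sandwich∙J a M b d =
    trans (∙-assoc _ _ _) (cong (J a ∙_) (trans (∙-assoc _ _ _) (cong (M ∙_) J-homomorphism)))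

  J∙sandwich∙J : ∀ {A A' B B' C D} (c : Hom B' C) (a : Hom A' B') (M : Hom A (T₀ A')) (b : Hom B A)
                 (d : Hom D B) → J c ∙ sandwich a M b ∙ J d ≡ sandwich (c ∘ a) M (b ∘ d)
  J∙sandwich∙J c a M b d = trans (cong (J c ∙_) (sandwich∙J a M b d)) (J∙sandwich c a M (b ∘ d))

  sandwich-slide : ∀ {X X' A B A'' B''} (a : Hom (X' ⊗₀ B) B'') (p : Hom X X') (k : Hom A (T₀ B))
                   (b : Hom A'' (X ⊗₀ A)) →
                   sandwich a (X' ⊗ˡ k) ((p ⊗₁ id) ∘ b) ≡ sandwich (a ∘ (p ⊗₁ id)) (X ⊗ˡ k) b
  sandwich-slide {X} {X'} a p k b = begin
    J a ∙ X' ⊗ˡ k ∙ J ((p ⊗₁ id) ∘ b)        ≡⟨ cong (λ z → J a ∙ X' ⊗ˡ k ∙ z) (sym J-homomorphism) ⟩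
    J a ∙ X' ⊗ˡ k ∙ J (p ⊗₁ id) ∙ J b        ≡⟨ cong (J a ∙_) (K.extendʳ (⊗ˡ-natural p k)) ⟩
    J a ∙ J (p ⊗₁ id) ∙ X ⊗ˡ k ∙ J b         ≡⟨ K.pullˡ J-homomorphism ⟩
    sandwich (a ∘ (p ⊗₁ id)) (X ⊗ˡ k) b      ∎

  ⊗ˡ-⊗ˡ : ∀ X Y {Z Z'} (k : Hom Z (T₀ Z')) →
          X ⊗ˡ (Y ⊗ˡ k) ≡ sandwich (α⁻¹ X Y Z') ((X ⊗₀ Y) ⊗ˡ k) (α X Y Z)
  ⊗ˡ-⊗ˡ X Y k = begin
    X ⊗ˡ (Y ⊗ˡ k)                                   ≡⟨ sym (∙-identityˡ _) ⟩
    η _ ∙ X ⊗ˡ (Y ⊗ˡ k)                             ≡⟨ cong (_∙ X ⊗ˡ (Y ⊗ˡ k)) (sym (J-inverse α⁻¹∘α)) ⟩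
    (J (α⁻¹ X Y _) ∙ J (α X Y _)) ∙ X ⊗ˡ (Y ⊗ˡ k)   ≡⟨ ∙-assoc _ _ _ ⟩
    J (α⁻¹ X Y _) ∙ J (α X Y _) ∙ X ⊗ˡ (Y ⊗ˡ k)     ≡⟨ cong (J (α⁻¹ X Y _) ∙_) (α-⊗ˡ-⊗ˡ X Y k) ⟩
    sandwich (α⁻¹ X Y _) ((X ⊗₀ Y) ⊗ˡ k) (α X Y _)  ∎

  ⊗ˡ-⊗ʳ : ∀ X Y {B B'} (k : Hom B (T₀ B')) →
          X ⊗ˡ (k ⊗ʳ Y) ≡ sandwich ((id ⊗₁ σ Y B') ∘ α⁻¹ X Y B') ((X ⊗₀ Y) ⊗ˡ k)
                                   (α X Y B ∘ (id ⊗₁ σ B Y))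
  ⊗ˡ-⊗ʳ X Y k = begin
    X ⊗ˡ (k ⊗ʳ Y)
      ≡⟨ cong (X ⊗ˡ_) (⊗ʳ-conjugate Y k) ⟩
    X ⊗ˡ (J (σ _ _) ∙ Y ⊗ˡ k ∙ J (σ _ _))
      ≡⟨ trans (⊗ˡ-∙ X _ _) (cong (X ⊗ˡ J (σ _ _) ∙_) (⊗ˡ-∙ X _ _)) ⟩
    X ⊗ˡ J (σ _ _) ∙ X ⊗ˡ (Y ⊗ˡ k) ∙ X ⊗ˡ J (σ _ _)
      ≡⟨ cong₂ (λ u v → u ∙ X ⊗ˡ (Y ⊗ˡ k) ∙ v) (⊗ˡ-J X _) (⊗ˡ-J X _) ⟩
    J (id ⊗₁ σ _ _) ∙ X ⊗ˡ (Y ⊗ˡ k) ∙ J (id ⊗₁ σ _ _)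
      ≡⟨ cong (λ z → J (id ⊗₁ σ _ _) ∙ z ∙ J (id ⊗₁ σ _ _)) (⊗ˡ-⊗ˡ X Y k) ⟩
    J (id ⊗₁ σ _ _) ∙ sandwich (α⁻¹ X Y _) ((X ⊗₀ Y) ⊗ˡ k) (α X Y _) ∙ J (id ⊗₁ σ _ _)
      ≡⟨ J∙sandwich∙J _ _ _ _ _ ⟩
    sandwich ((id ⊗₁ σ Y _) ∘ α⁻¹ X Y _) ((X ⊗₀ Y) ⊗ˡ k) (α X Y _ ∘ (id ⊗₁ σ _ Y)) ∎

  α-⊗ˡ-⊗ʳ : ∀ A C {B B'} (g : Hom B (T₀ B')) →
            J (α A B' C) ∙ A ⊗ˡ (g ⊗ʳ C) ≡ (A ⊗ˡ g) ⊗ʳ C ∙ J (α A B C)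
  α-⊗ˡ-⊗ʳ A C {B} {B'} g = begin
    J (α A B' C) ∙ A ⊗ˡ (g ⊗ʳ C)
      ≡⟨ cong (J (α A B' C) ∙_) (⊗ˡ-⊗ʳ A C g) ⟩
    J (α A B' C) ∙ sandwich ((id ⊗₁ σ C B') ∘ α⁻¹ A C B') ((A ⊗₀ C) ⊗ˡ g) (α A C B ∘ (id ⊗₁ σ B C))
      ≡⟨ J∙sandwich _ _ _ _ ⟩
    sandwich (α A B' C ∘ ((id ⊗₁ σ C B') ∘ α⁻¹ A C B')) ((A ⊗₀ C) ⊗ˡ g) (α A C B ∘ (id ⊗₁ σ B C))
      ≡⟨ cong (λ z → sandwich z ((A ⊗₀ C) ⊗ˡ g) (α A C B ∘ (id ⊗₁ σ B C)))
           (sym (trans assoc′ (exchange-coherence A B' C))) ⟩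
    sandwich ((σ C (A ⊗₀ B') ∘ α⁻¹ C A B') ∘ (σ A C ⊗₁ id)) ((A ⊗₀ C) ⊗ˡ g) (α A C B ∘ (id ⊗₁ σ B C))
      ≡⟨ sym (sandwich-slide _ _ _ _) ⟩
    sandwich (σ C (A ⊗₀ B') ∘ α⁻¹ C A B') ((C ⊗₀ A) ⊗ˡ g) ((σ A C ⊗₁ id) ∘ (α A C B ∘ (id ⊗₁ σ B C)))
      ≡⟨ cong (sandwich (σ C (A ⊗₀ B') ∘ α⁻¹ C A B') ((C ⊗₀ A) ⊗ˡ g))
           (trans (sym (hexagon A B C)) (sym assoc′)) ⟩
    sandwich (σ C (A ⊗₀ B') ∘ α⁻¹ C A B') ((C ⊗₀ A) ⊗ˡ g) ((α C A B ∘ σ (A ⊗₀ B) C) ∘ α A B C)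
      ≡⟨ sym (sandwich∙J _ _ _ _) ⟩
    sandwich (σ C (A ⊗₀ B') ∘ α⁻¹ C A B') ((C ⊗₀ A) ⊗ˡ g) (α C A B ∘ σ (A ⊗₀ B) C) ∙ J (α A B C)
      ≡⟨ cong (_∙ J (α A B C)) (sym (J∙sandwich∙J _ _ _ _ _)) ⟩
    (J (σ C (A ⊗₀ B')) ∙ sandwich (α⁻¹ C A B') ((C ⊗₀ A) ⊗ˡ g) (α C A B) ∙ J (σ (A ⊗₀ B) C))
      ∙ J (α A B C)
      ≡⟨ cong (λ z → (J (σ C (A ⊗₀ B')) ∙ z ∙ J (σ (A ⊗₀ B) C)) ∙ J (α A B C)) (sym (⊗ˡ-⊗ˡ C A g)) ⟩
    (J (σ C (A ⊗₀ B')) ∙ C ⊗ˡ (A ⊗ˡ g) ∙ J (σ (A ⊗₀ B) C)) ∙ J (α A B C)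
      ≡⟨ cong (_∙ J (α A B C)) (sym (⊗ʳ-conjugate C (A ⊗ˡ g))) ⟩
    (A ⊗ˡ g) ⊗ʳ C ∙ J (α A B C) ∎

  α-⊗ʳ-⊗ʳ : ∀ B C {A A'} (f : Hom A (T₀ A')) →
            J (α A' B C) ∙ f ⊗ʳ (B ⊗₀ C) ≡ f ⊗ʳ B ⊗ʳ C ∙ J (α A B C)
  α-⊗ʳ-⊗ʳ B C {A} {A'} f = begin
    J (α A' B C) ∙ f ⊗ʳ (B ⊗₀ C)
      ≡⟨ cong (J (α A' B C) ∙_) (⊗ʳ-conjugate _ f) ⟩
    J (α A' B C) ∙ sandwich (σ (B ⊗₀ C) A') ((B ⊗₀ C) ⊗ˡ f) (σ A (B ⊗₀ C))
      ≡⟨ J∙sandwich _ _ _ _ ⟩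
    sandwich (α A' B C ∘ σ (B ⊗₀ C) A') ((B ⊗₀ C) ⊗ˡ f) (σ A (B ⊗₀ C))
      ≡⟨ cong (λ z → sandwich z ((B ⊗₀ C) ⊗ˡ f) (σ A (B ⊗₀ C)))
           (sym (trans assoc² (rotation-coherence A' B C))) ⟩
    sandwich (a ∘ (σ B C ⊗₁ id)) ((B ⊗₀ C) ⊗ˡ f) (σ A (B ⊗₀ C))
      ≡⟨ sym (sandwich-slide _ _ _ _) ⟩
    sandwich a ((C ⊗₀ B) ⊗ˡ f) ((σ B C ⊗₁ id) ∘ σ A (B ⊗₀ C))
      ≡⟨ cong (sandwich a ((C ⊗₀ B) ⊗ˡ f))
           (sym (trans assoc′ (trans assoc′ (reversal-coherence A B C)))) ⟩
    sandwich a ((C ⊗₀ B) ⊗ˡ f) (((α C B A ∘ (id ⊗₁ σ A B)) ∘ σ (A ⊗₀ B) C) ∘ α A B C)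
      ≡⟨ sym (sandwich∙J _ _ _ _) ⟩
    sandwich a ((C ⊗₀ B) ⊗ˡ f) ((α C B A ∘ (id ⊗₁ σ A B)) ∘ σ (A ⊗₀ B) C) ∙ J (α A B C)
      ≡⟨ cong (_∙ J (α A B C)) (sym (J∙sandwich∙J _ _ _ _ _)) ⟩
    (J (σ C (A' ⊗₀ B)) ∙ sandwich ((id ⊗₁ σ B A') ∘ α⁻¹ C B A') ((C ⊗₀ B) ⊗ˡ f) (α C B A ∘ (id ⊗₁ σ A B))
      ∙ J (σ (A ⊗₀ B) C)) ∙ J (α A B C)
      ≡⟨ cong (λ z → (J (σ C (A' ⊗₀ B)) ∙ z ∙ J (σ (A ⊗₀ B) C)) ∙ J (α A B C)) (sym (⊗ˡ-⊗ʳ C B f)) ⟩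
    (J (σ C (A' ⊗₀ B)) ∙ C ⊗ˡ (f ⊗ʳ B) ∙ J (σ (A ⊗₀ B) C)) ∙ J (α A B C)
      ≡⟨ cong (_∙ J (α A B C)) (sym (⊗ʳ-conjugate C (f ⊗ʳ B))) ⟩
    f ⊗ʳ B ⊗ʳ C ∙ J (α A B C) ∎
    where
    a : Hom ((C ⊗₀ B) ⊗₀ A') ((A' ⊗₀ B) ⊗₀ C)
    a = σ C (A' ⊗₀ B) ∘ ((id ⊗₁ σ B A') ∘ α⁻¹ C B A')

  ⊗ₖ-identity : ∀ {A B} → η A ⊗ₖ η B ≡ η (A ⊗₀ B)
  ⊗ₖ-identity = trans (⊗ₖ≡⊗ʳ∙⊗ˡ _ _) (trans (cong₂ _∙_ (⊗ʳ-η _) (⊗ˡ-η _)) (∙-identityˡ _))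

  ⊗ₖ-homomorphism : ∀ {A B C A' B' C'} (f : Hom A (T₀ B)) (g : Hom B (T₀ C))
                    (f' : Hom A' (T₀ B')) (g' : Hom B' (T₀ C')) →
                    (g ∙ f) ⊗ₖ (g' ∙ f') ≡ g ⊗ₖ g' ∙ f ⊗ₖ f'
  ⊗ₖ-homomorphism f g f' g' = begin
    (g ∙ f) ⊗ₖ (g' ∙ f')
      ≡⟨ ⊗ₖ≡⊗ʳ∙⊗ˡ _ _ ⟩
    (g ∙ f) ⊗ʳ _ ∙ _ ⊗ˡ (g' ∙ f')
      ≡⟨ cong₂ _∙_ (⊗ʳ-∙ _ g f) (⊗ˡ-∙ _ g' f') ⟩
    (g ⊗ʳ _ ∙ f ⊗ʳ _) ∙ (_ ⊗ˡ g' ∙ _ ⊗ˡ f')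
      ≡⟨ trans (∙-assoc _ _ _) (cong (g ⊗ʳ _ ∙_) (sym (∙-assoc _ _ _))) ⟩
    g ⊗ʳ _ ∙ (f ⊗ʳ _ ∙ _ ⊗ˡ g') ∙ _ ⊗ˡ f'
      ≡⟨ cong (λ z → g ⊗ʳ _ ∙ z ∙ _ ⊗ˡ f') (⊗ʳ-⊗ˡ-interchange f g') ⟩
    g ⊗ʳ _ ∙ (_ ⊗ˡ g' ∙ f ⊗ʳ _) ∙ _ ⊗ˡ f'
      ≡⟨ trans (cong (g ⊗ʳ _ ∙_) (∙-assoc _ _ _)) (sym (∙-assoc _ _ _)) ⟩
    (g ⊗ʳ _ ∙ _ ⊗ˡ g') ∙ (f ⊗ʳ _ ∙ _ ⊗ˡ f')
      ≡⟨ sym (cong₂ _∙_ (⊗ₖ≡⊗ʳ∙⊗ˡ g g') (⊗ₖ≡⊗ʳ∙⊗ˡ f f')) ⟩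
    g ⊗ₖ g' ∙ f ⊗ₖ f' ∎

  J⊗ₖJ : ∀ {A B A' B'} (f : Hom A B) (g : Hom A' B') → J f ⊗ₖ J g ≡ J (f ⊗₁ g)
  J⊗ₖJ f g = begin
    dst _ _ ∘ ((η _ ∘ f) ⊗₁ (η _ ∘ g))         ≡⟨ cong (dst _ _ ∘_) (⊗-homomorphism f (η _) g (η _)) ⟩
    dst _ _ ∘ ((η _ ⊗₁ η _) ∘ (f ⊗₁ g))        ≡⟨ pullˡ ⊗ₖ-identity ⟩
    J (f ⊗₁ g)                                 ∎

  J⊗ₖη : ∀ {A B} C (f : Hom A B) → J f ⊗ₖ η C ≡ J (f ⊗₁ id)
  J⊗ₖη C f = trans (cong (J f ⊗ₖ_) (sym J-identity)) (J⊗ₖJ f id)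

  η⊗ₖJ : ∀ {A B} C (f : Hom A B) → η C ⊗ₖ J f ≡ J (id ⊗₁ f)
  η⊗ₖJ C f = trans (cong (_⊗ₖ J f) (sym J-identity)) (J⊗ₖJ id f)

  kleisli-α-natural : ∀ {A B C A' B' C'} (f : Hom A (T₀ A')) (g : Hom B (T₀ B'))
                      (h : Hom C (T₀ C')) →
                      J (α A' B' C') ∙ f ⊗ₖ (g ⊗ₖ h) ≡ (f ⊗ₖ g) ⊗ₖ h ∙ J (α A B C)
  kleisli-α-natural {A} {B} {C} {A'} {B'} {C'} f g h = begin
    J (α A' B' C') ∙ f ⊗ₖ (g ⊗ₖ h)
      ≡⟨ cong (J (α A' B' C') ∙_) (trans (⊗ₖ≡⊗ʳ∙⊗ˡ f _)
           (cong (f ⊗ʳ _ ∙_) (trans (cong (A ⊗ˡ_) (⊗ₖ≡⊗ʳ∙⊗ˡ g h)) (⊗ˡ-∙ A _ _)))) ⟩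
    J (α A' B' C') ∙ f ⊗ʳ (B' ⊗₀ C') ∙ A ⊗ˡ (g ⊗ʳ C') ∙ A ⊗ˡ (B ⊗ˡ h)
      ≡⟨ K.extendʳ (α-⊗ʳ-⊗ʳ B' C' f) ⟩
    f ⊗ʳ B' ⊗ʳ C' ∙ J (α A B' C') ∙ A ⊗ˡ (g ⊗ʳ C') ∙ A ⊗ˡ (B ⊗ˡ h)
      ≡⟨ cong (f ⊗ʳ B' ⊗ʳ C' ∙_) (K.extendʳ (α-⊗ˡ-⊗ʳ A C' g)) ⟩
    f ⊗ʳ B' ⊗ʳ C' ∙ (A ⊗ˡ g) ⊗ʳ C' ∙ J (α A B C') ∙ A ⊗ˡ (B ⊗ˡ h)
      ≡⟨ cong (λ z → f ⊗ʳ B' ⊗ʳ C' ∙ (A ⊗ˡ g) ⊗ʳ C' ∙ z) (α-⊗ˡ-⊗ˡ A B h) ⟩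
    f ⊗ʳ B' ⊗ʳ C' ∙ (A ⊗ˡ g) ⊗ʳ C' ∙ (A ⊗₀ B) ⊗ˡ h ∙ J (α A B C)
      ≡⟨ sym (trans (∙-assoc _ _ _) (∙-assoc _ _ _)) ⟩
    ((f ⊗ʳ B' ⊗ʳ C' ∙ (A ⊗ˡ g) ⊗ʳ C') ∙ (A ⊗₀ B) ⊗ˡ h) ∙ J (α A B C)
      ≡⟨ cong (λ z → (z ∙ (A ⊗₀ B) ⊗ˡ h) ∙ J (α A B C))
           (sym (trans (cong (_⊗ʳ C') (⊗ₖ≡⊗ʳ∙⊗ˡ f g)) (⊗ʳ-∙ C' _ _))) ⟩
    ((f ⊗ₖ g) ⊗ʳ C' ∙ (A ⊗₀ B) ⊗ˡ h) ∙ J (α A B C)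
      ≡⟨ cong (_∙ J (α A B C)) (sym (⊗ₖ≡⊗ʳ∙⊗ˡ _ h)) ⟩
    (f ⊗ₖ g) ⊗ₖ h ∙ J (α A B C) ∎

  kleisli-λ-natural : ∀ {A B} (f : Hom A (T₀ B)) → J (λ' B) ∙ η unit ⊗ₖ f ≡ f ∙ J (λ' A)
  kleisli-λ-natural f = begin
    J (λ' _) ∙ η unit ⊗ₖ f               ≡⟨ cong (J (λ' _) ∙_) (⊗ₖ≡⊗ʳ∙⊗ˡ _ f) ⟩
    J (λ' _) ∙ η unit ⊗ʳ _ ∙ unit ⊗ˡ f   ≡⟨ cong (λ z → J (λ' _) ∙ z ∙ unit ⊗ˡ f) (⊗ʳ-η _) ⟩
    J (λ' _) ∙ η _ ∙ unit ⊗ˡ f           ≡⟨ cong (J (λ' _) ∙_) (∙-identityˡ _) ⟩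
    J (λ' _) ∙ unit ⊗ˡ f                 ≡⟨ λ-⊗ˡ f ⟩
    f ∙ J (λ' _)                         ∎

  kleisli-ρ-natural : ∀ {A B} (f : Hom A (T₀ B)) → J (ρ B) ∙ f ⊗ₖ η unit ≡ f ∙ J (ρ A)
  kleisli-ρ-natural f = begin
    J (ρ _) ∙ f ⊗ₖ η unit
      ≡⟨ cong (J (ρ _) ∙_) (trans (⊗ₖ≡⊗ʳ∙⊗ˡ f _) (trans (cong (f ⊗ʳ _ ∙_) (⊗ˡ-η _)) (∙-identityʳ _))) ⟩
    J (ρ _) ∙ f ⊗ʳ unit
      ≡⟨ cong (J (ρ _) ∙_) (⊗ʳ-conjugate unit f) ⟩
    J (ρ _) ∙ J (σ unit _) ∙ unit ⊗ˡ f ∙ J (σ _ unit)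
      ≡⟨ K.pullˡ (trans J-homomorphism (cong J (ρ∘σ _))) ⟩
    J (λ' _) ∙ unit ⊗ˡ f ∙ J (σ _ unit)
      ≡⟨ K.pullˡ (λ-⊗ˡ f) ⟩
    (f ∙ J (λ' _)) ∙ J (σ _ unit)
      ≡⟨ trans (∙-assoc _ _ _) (cong (f ∙_) (trans J-homomorphism (cong J (λ∘σ _)))) ⟩
    f ∙ J (ρ _) ∎

  kleisli-σ-natural : ∀ {A B A' B'} (f : Hom A (T₀ A')) (g : Hom B (T₀ B')) →
                      J (σ A' B') ∙ f ⊗ₖ g ≡ g ⊗ₖ f ∙ J (σ A B)
  kleisli-σ-natural f g = begin
    J (σ _ _) ∙ f ⊗ₖ g
      ≡⟨ cong (J (σ _ _) ∙_) (⊗ₖ≡⊗ʳ∙⊗ˡ f g) ⟩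
    J (σ _ _) ∙ f ⊗ʳ _ ∙ _ ⊗ˡ g
      ≡⟨ K.pullˡ (σ-⊗ʳ _ f) ⟩
    (_ ⊗ˡ f ∙ J (σ _ _)) ∙ _ ⊗ˡ g
      ≡⟨ trans (∙-assoc _ _ _) (cong (_ ⊗ˡ f ∙_) (σ-⊗ˡ _ g)) ⟩
    _ ⊗ˡ f ∙ g ⊗ʳ _ ∙ J (σ _ _)
      ≡⟨ sym (∙-assoc _ _ _) ⟩
    (_ ⊗ˡ f ∙ g ⊗ʳ _) ∙ J (σ _ _)
      ≡⟨ cong (_∙ J (σ _ _)) (sym (trans (⊗ₖ≡⊗ʳ∙⊗ˡ g f) (⊗ʳ-⊗ˡ-interchange g f))) ⟩
    g ⊗ₖ f ∙ J (σ _ _) ∎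

  kleisli-pentagon : ∀ A B C D →
    J (α (A ⊗₀ B) C D) ∙ J (α A B (C ⊗₀ D))
    ≡ J (α A B C) ⊗ₖ η D ∙ J (α A (B ⊗₀ C) D) ∙ η A ⊗ₖ J (α B C D)
  kleisli-pentagon A B C D = begin
    J (α (A ⊗₀ B) C D) ∙ J (α A B (C ⊗₀ D))
      ≡⟨ trans J-homomorphism (cong J (pentagon A B C D)) ⟩
    J ((α A B C ⊗₁ id) ∘ (α A (B ⊗₀ C) D ∘ (id ⊗₁ α B C D)))
      ≡⟨ sym (trans (cong (J (α A B C ⊗₁ id) ∙_) J-homomorphism) J-homomorphism) ⟩
    J (α A B C ⊗₁ id) ∙ J (α A (B ⊗₀ C) D) ∙ J (id ⊗₁ α B C D)
      ≡⟨ sym (cong₂ (λ u v → u ∙ J (α A (B ⊗₀ C) D) ∙ v) (J⊗ₖη D _) (η⊗ₖJ A _)) ⟩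
    J (α A B C) ⊗ₖ η D ∙ J (α A (B ⊗₀ C) D) ∙ η A ⊗ₖ J (α B C D) ∎

  kleisli-triangle : ∀ A B → J (ρ A) ⊗ₖ η B ∙ J (α A unit B) ≡ η A ⊗ₖ J (λ' B)
  kleisli-triangle A B = begin
    J (ρ A) ⊗ₖ η B ∙ J (α A unit B)     ≡⟨ cong (_∙ J (α A unit B)) (J⊗ₖη B _) ⟩
    J (ρ A ⊗₁ id) ∙ J (α A unit B)      ≡⟨ trans J-homomorphism (cong J (triangle A B)) ⟩
    J (id ⊗₁ λ' B)                      ≡⟨ sym (η⊗ₖJ A _) ⟩
    η A ⊗ₖ J (λ' B)                     ∎

  kleisli-hexagon : ∀ A B C →
    J (α C A B) ∙ J (σ (A ⊗₀ B) C) ∙ J (α A B C)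
    ≡ J (σ A C) ⊗ₖ η B ∙ J (α A C B) ∙ η A ⊗ₖ J (σ B C)
  kleisli-hexagon A B C = begin
    J (α C A B) ∙ J (σ (A ⊗₀ B) C) ∙ J (α A B C)
      ≡⟨ trans (cong (J (α C A B) ∙_) J-homomorphism) (trans J-homomorphism (cong J (hexagon A B C))) ⟩
    J ((σ A C ⊗₁ id) ∘ (α A C B ∘ (id ⊗₁ σ B C)))
      ≡⟨ sym (trans (cong (J (σ A C ⊗₁ id) ∙_) J-homomorphism) J-homomorphism) ⟩
    J (σ A C ⊗₁ id) ∙ J (α A C B) ∙ J (id ⊗₁ σ B C)
      ≡⟨ sym (cong₂ (λ u v → u ∙ J (α A C B) ∙ v) (J⊗ₖη B _) (η⊗ₖJ A _)) ⟩
    J (σ A C) ⊗ₖ η B ∙ J (α A C B) ∙ η A ⊗ₖ J (σ B C) ∎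

  kleisli-isSymmetricMonoidal : IsSymmetricMonoidal kleisli kleisli-monoidal
  kleisli-isSymmetricMonoidal = record
    { ⊗-identity = ⊗ₖ-identity
    ; ⊗-homomorphism = ⊗ₖ-homomorphism
    ; α-natural = kleisli-α-natural
    ; λ-natural = kleisli-λ-natural
    ; ρ-natural = kleisli-ρ-natural
    ; σ-natural = kleisli-σ-natural
    ; α-iso = λ A B C → J-preserves-iso (α-iso A B C)
    ; λ-iso = λ A → J-preserves-iso (λ-iso A)
    ; ρ-iso = λ A → J-preserves-iso (ρ-iso A)
    ; σ-iso = λ A B → J-preserves-iso (σ-iso A B)
    ; pentagon = kleisli-pentagon
    ; triangle = kleisli-triangle
    ; hexagon = kleisli-hexagon
    ; symmetry = λ A B → J-symmetry
    }

  infix 11 _†ₖ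
  _†ₖ : ∀ {A B} → Hom A (T₀ B) → Hom B (T₀ A)
  f †ₖ = kleisli-† f

  †-∘ : ∀ {A B C} (g : Hom B C) (f : Hom A B) → † (g ∘ f) ≡ † f ∘ † g
  †-∘ g f = †-homomorphism f g

  †-T₁ : ∀ {A B} (f : Hom A B) → † (T₁ f) ≡ T₁ († f)
  †-T₁ f = sym (T-† f)

  †-T₁-† : ∀ {A B} (f : Hom A B) → † (T₁ († f)) ≡ T₁ f
  †-T₁-† f = trans (†-T₁ _) (cong T₁ (†-involutive f))

  μ-unitˡ† : ∀ {A} → T₁ († (η A)) ∘ † (μ A) ≡ id
  μ-unitˡ† = trans (cong (_∘ † (μ _)) (T-† (η _)))
               (trans (sym (†-∘ _ _)) (trans (cong † (μ-unitˡ _)) †-identity))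

  μ†-natural : ∀ {A B} (f : Hom A B) → † (μ B) ∘ T₁ f ≡ T₁ (T₁ f) ∘ † (μ A)
  μ†-natural f = begin
    † (μ _) ∘ T₁ f                   ≡⟨ cong († (μ _) ∘_) (sym (†-T₁-† f)) ⟩
    † (μ _) ∘ † (T₁ († f))           ≡⟨ sym (†-∘ _ _) ⟩
    † (T₁ († f) ∘ μ _)               ≡⟨ cong † (sym (μ-natural († f))) ⟩
    † (μ _ ∘ T₁ (T₁ († f)))          ≡⟨ †-∘ _ _ ⟩
    † (T₁ (T₁ († f))) ∘ † (μ _)      ≡⟨ cong (_∘ † (μ _)) (trans (†-T₁ _) (cong T₁ (†-T₁-† f))) ⟩
    T₁ (T₁ f) ∘ † (μ _)              ∎

  μ-assoc† : ∀ {A} → T₁ († (μ A)) ∘ † (μ A) ≡ † (μ (T₀ A)) ∘ † (μ A)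
  μ-assoc† = trans (cong (_∘ † (μ _)) (T-† _))
               (trans (sym (†-∘ _ _)) (trans (cong † (μ-assoc _)) (†-∘ _ _)))

  †ₖ-identity : ∀ {A} → η A †ₖ ≡ η A
  †ₖ-identity = trans (pullˡ μ-unitˡ†) idˡ

  †ₖ-J : ∀ {A B} (h : Hom A B) → J h †ₖ ≡ J († h)
  †ₖ-J h = begin
    T₁ († (η _ ∘ h)) ∘ († (μ _) ∘ η _)
      ≡⟨ cong (λ z → T₁ z ∘ († (μ _) ∘ η _)) (†-∘ _ _) ⟩
    T₁ († h ∘ † (η _)) ∘ († (μ _) ∘ η _)
      ≡⟨ trans (cong (_∘ († (μ _) ∘ η _)) (T-homomorphism _ _)) assoc′ ⟩
    T₁ († h) ∘ (T₁ († (η _)) ∘ († (μ _) ∘ η _))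
      ≡⟨ cong (T₁ († h) ∘_) (cancelˡ μ-unitˡ†) ⟩
    T₁ († h) ∘ η _
      ≡⟨ sym (η-natural _) ⟩
    J († h) ∎

  †ₖ-involutive : ∀ {A B} (f : Hom A (T₀ B)) → f †ₖ †ₖ ≡ f
  †ₖ-involutive f = begin
    T₁ († (T₁ († f) ∘ († (μ _) ∘ η _))) ∘ († (μ _) ∘ η _)
      ≡⟨ cong (λ z → T₁ z ∘ († (μ _) ∘ η _)) †-unfolded ⟩
    T₁ († (η _) ∘ (μ _ ∘ T₁ f)) ∘ († (μ _) ∘ η _)
      ≡⟨ trans (cong (_∘ († (μ _) ∘ η _)) T-homomorphism²) assoc² ⟩
    T₁ († (η _)) ∘ (T₁ (μ _) ∘ (T₁ (T₁ f) ∘ († (μ _) ∘ η _)))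
      ≡⟨ cong (λ z → T₁ († (η _)) ∘ (T₁ (μ _) ∘ z)) (extendʳ (sym (μ†-natural f))) ⟩
    T₁ († (η _)) ∘ (T₁ (μ _) ∘ († (μ _) ∘ (T₁ f ∘ η _)))
      ≡⟨ cong (λ z → T₁ († (η _)) ∘ (T₁ (μ _) ∘ († (μ _) ∘ z))) (sym (η-natural f)) ⟩
    T₁ († (η _)) ∘ (T₁ (μ _) ∘ († (μ _) ∘ (η _ ∘ f)))
      ≡⟨ cong (T₁ († (η _)) ∘_) (extendʳ (frobenius _)) ⟩
    T₁ († (η _)) ∘ (μ _ ∘ (T₁ († (μ _)) ∘ (η _ ∘ f)))
      ≡⟨ cong (λ z → T₁ († (η _)) ∘ (μ _ ∘ z)) (extendʳ (sym (η-natural _))) ⟩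
    T₁ († (η _)) ∘ (μ _ ∘ (η _ ∘ († (μ _) ∘ f)))
      ≡⟨ cong (T₁ († (η _)) ∘_) (cancelˡ (μ-unitʳ _)) ⟩
    T₁ († (η _)) ∘ († (μ _) ∘ f)
      ≡⟨ cancelˡ μ-unitˡ† ⟩
    f ∎
    where
    †-unfolded : † (T₁ († f) ∘ († (μ _) ∘ η _)) ≡ † (η _) ∘ (μ _ ∘ T₁ f)
    †-unfolded = trans (†-∘ _ _) (trans (cong₂ _∘_ (trans (†-∘ _ _) (cong († (η _) ∘_) (†-involutive _)))
                   (†-T₁-† f)) assoc′)

  †ₖ-homomorphism : ∀ {A B C} (f : Hom A (T₀ B)) (g : Hom B (T₀ C)) → (g ∙ f) †ₖ ≡ f †ₖ ∙ g †ₖ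
  †ₖ-homomorphism f g = begin
    T₁ († (μ _ ∘ (T₁ g ∘ f))) ∘ († (μ _) ∘ η _)
      ≡⟨ cong (λ z → T₁ z ∘ († (μ _) ∘ η _)) †-unfolded ⟩
    T₁ († f ∘ (T₁ († g) ∘ † (μ _))) ∘ († (μ _) ∘ η _)
      ≡⟨ trans (cong (_∘ († (μ _) ∘ η _)) T-homomorphism²) assoc² ⟩
    T₁ († f) ∘ (T₁ (T₁ († g)) ∘ (T₁ († (μ _)) ∘ († (μ _) ∘ η _)))
      ≡⟨ cong (λ z → T₁ († f) ∘ (T₁ (T₁ († g)) ∘ z)) (extendʳ μ-assoc†) ⟩
    T₁ († f) ∘ (T₁ (T₁ († g)) ∘ († (μ _) ∘ († (μ _) ∘ η _)))
      ≡⟨ cong (T₁ († f) ∘_) (extendʳ (sym (μ†-natural _))) ⟩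
    T₁ († f) ∘ († (μ _) ∘ (T₁ († g) ∘ († (μ _) ∘ η _)))
      ≡⟨ cong (T₁ († f) ∘_) (sym (cancelˡ (trans T₁-∘ (trans (cong T₁ (μ-unitˡ _)) T-identity)))) ⟩
    T₁ († f) ∘ (T₁ (μ _) ∘ (T₁ (T₁ (η _)) ∘ († (μ _) ∘ (T₁ († g) ∘ († (μ _) ∘ η _)))))
      ≡⟨ cong (λ z → T₁ († f) ∘ (T₁ (μ _) ∘ z)) (extendʳ (sym (μ†-natural _))) ⟩
    T₁ († f) ∘ (T₁ (μ _) ∘ († (μ _) ∘ (T₁ (η _) ∘ (T₁ († g) ∘ († (μ _) ∘ η _)))))
      ≡⟨ cong (T₁ († f) ∘_) (extendʳ (frobenius _)) ⟩
    T₁ († f) ∘ (μ _ ∘ (T₁ († (μ _)) ∘ (T₁ (η _) ∘ (T₁ († g) ∘ († (μ _) ∘ η _)))))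
      ≡⟨ extendʳ (sym (μ-natural _)) ⟩
    μ _ ∘ (T₁ (T₁ († f)) ∘ (T₁ († (μ _)) ∘ (T₁ (η _) ∘ (T₁ († g) ∘ († (μ _) ∘ η _)))))
      ≡⟨ cong (μ _ ∘_) (sym assoc³) ⟩
    μ _ ∘ ((T₁ (T₁ († f)) ∘ (T₁ († (μ _)) ∘ (T₁ (η _) ∘ T₁ († g)))) ∘ († (μ _) ∘ η _))
      ≡⟨ cong (λ z → μ _ ∘ (z ∘ († (μ _) ∘ η _))) (sym T-homomorphism³) ⟩
    μ _ ∘ (T₁ (T₁ († f) ∘ († (μ _) ∘ (η _ ∘ † g))) ∘ († (μ _) ∘ η _))
      ≡⟨ cong (λ z → μ _ ∘ (T₁ z ∘ († (μ _) ∘ η _))) (sym assoc²) ⟩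
    μ _ ∘ (T₁ ((T₁ († f) ∘ († (μ _) ∘ η _)) ∘ † g) ∘ († (μ _) ∘ η _))
      ≡⟨ cong (μ _ ∘_) (trans (cong (_∘ († (μ _) ∘ η _)) (T-homomorphism _ _)) assoc′) ⟩
    f †ₖ ∙ g †ₖ ∎
    where
    †-unfolded : † (μ _ ∘ (T₁ g ∘ f)) ≡ † f ∘ (T₁ († g) ∘ † (μ _))
    †-unfolded = trans (†-∘ _ _) (trans (cong (_∘ † (μ _)) (trans (†-∘ _ _) (cong († f ∘_) (†-T₁ g))))
                   assoc′)

    T-homomorphism³ : ∀ {A B C D E} {f : Hom A B} {g : Hom B C} {h : Hom C D} {i : Hom D E} →
                      T₁ (i ∘ (h ∘ (g ∘ f))) ≡ T₁ i ∘ (T₁ h ∘ (T₁ g ∘ T₁ f))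
    T-homomorphism³ = trans (T-homomorphism _ _) (cong (_ ∘_) T-homomorphism²)

  st-μ† : ∀ X B → st X (T₀ B) ∘ (id ⊗₁ † (μ B)) ≡ T₁ († (st X B)) ∘ († (μ (X ⊗₀ B)) ∘ st X B)
  st-μ† X B = begin
    st X (T₀ B) ∘ (id ⊗₁ † (μ B))
      ≡⟨ cong (st X (T₀ B) ∘_) (sym (trans (cong ((id ⊗₁ † (μ B)) ∘_) (proj₁ (st-unitary X B))) idʳ)) ⟩
    st X (T₀ B) ∘ ((id ⊗₁ † (μ B)) ∘ († (st X B) ∘ st X B))
      ≡⟨ cong (st X (T₀ B) ∘_) (trans (pullˡ st-μ-dagger) assoc²) ⟩
    st X (T₀ B) ∘ († (st X (T₀ B)) ∘ (T₁ († (st X B)) ∘ († (μ _) ∘ st X B)))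
      ≡⟨ cancelˡ (proj₂ (st-unitary X (T₀ B))) ⟩
    T₁ († (st X B)) ∘ († (μ (X ⊗₀ B)) ∘ st X B) ∎
    where
    st-μ-dagger : (id ⊗₁ † (μ B)) ∘ † (st X B) ≡ † (st X (T₀ B)) ∘ (T₁ († (st X B)) ∘ † (μ _))
    st-μ-dagger = begin
      (id ⊗₁ † (μ B)) ∘ † (st X B)
        ≡⟨ cong (λ z → (z ⊗₁ † (μ B)) ∘ † (st X B)) (sym †-identity) ⟩
      († id ⊗₁ † (μ B)) ∘ † (st X B)
        ≡⟨ cong (_∘ † (st X B)) (sym (†-⊗ _ _)) ⟩
      † (id ⊗₁ μ B) ∘ † (st X B)
        ≡⟨ sym (†-∘ _ _) ⟩
      † (st X B ∘ (id ⊗₁ μ B))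
        ≡⟨ cong † (st-μ X B) ⟩
      † (μ _ ∘ (T₁ (st X B) ∘ st X (T₀ B)))
        ≡⟨ trans (†-∘ _ _) (cong (_∘ † (μ _)) (†-∘ _ _)) ⟩
      († (st X (T₀ B)) ∘ † (T₁ (st X B))) ∘ † (μ _)
        ≡⟨ trans assoc′ (cong (λ z → † (st X (T₀ B)) ∘ (z ∘ † (μ _))) (†-T₁ _)) ⟩
      † (st X (T₀ B)) ∘ (T₁ († (st X B)) ∘ † (μ _)) ∎

  †ₖ-⊗ˡ : ∀ X {B C} (g : Hom B (T₀ C)) → (X ⊗ˡ g) †ₖ ≡ X ⊗ˡ (g †ₖ)
  †ₖ-⊗ˡ X g = begin
    T₁ († (st _ _ ∘ (id ⊗₁ g))) ∘ († (μ _) ∘ η _)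
      ≡⟨ cong (λ z → T₁ z ∘ († (μ _) ∘ η _))
           (trans (†-∘ _ _) (cong (_∘ † (st _ _)) (trans (†-⊗ _ _) (cong (_⊗₁ † g) †-identity)))) ⟩
    T₁ ((id ⊗₁ † g) ∘ † (st _ _)) ∘ († (μ _) ∘ η _)
      ≡⟨ trans (cong (_∘ († (μ _) ∘ η _)) (T-homomorphism _ _)) assoc′ ⟩
    T₁ (id ⊗₁ † g) ∘ (T₁ († (st _ _)) ∘ († (μ _) ∘ η _))
      ≡⟨ cong (λ z → T₁ (id ⊗₁ † g) ∘ (T₁ († (st _ _)) ∘ († (μ _) ∘ z))) (sym (st-η _ _)) ⟩
    T₁ (id ⊗₁ † g) ∘ (T₁ († (st _ _)) ∘ († (μ _) ∘ (st _ _ ∘ (id ⊗₁ η _))))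
      ≡⟨ cong (T₁ (id ⊗₁ † g) ∘_) (sym (trans (pullˡ (st-μ† X _)) assoc²)) ⟩
    T₁ (id ⊗₁ † g) ∘ (st _ _ ∘ ((id ⊗₁ † (μ _)) ∘ (id ⊗₁ η _)))
      ≡⟨ sym (extendʳ (st-natural id († g))) ⟩
    st _ _ ∘ ((id ⊗₁ T₁ († g)) ∘ ((id ⊗₁ † (μ _)) ∘ (id ⊗₁ η _)))
      ≡⟨ cong (st _ _ ∘_) (sym (trans id⊗-∘ (cong ((id ⊗₁ T₁ († g)) ∘_) id⊗-∘))) ⟩
    X ⊗ˡ (g †ₖ) ∎

  σ-† : ∀ {A B} → † (σ A B) ≡ σ B A
  σ-† {A} {B} = inverse-unique (proj₁ (σ-unitary A B)) σ∘σ

  †ₖ-⊗ʳ : ∀ Y {A B} (f : Hom A (T₀ B)) → (f ⊗ʳ Y) †ₖ ≡ (f †ₖ) ⊗ʳ Y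
  †ₖ-⊗ʳ Y f = begin
    (f ⊗ʳ Y) †ₖ
      ≡⟨ cong _†ₖ (⊗ʳ-conjugate Y f) ⟩
    (J (σ Y _) ∙ Y ⊗ˡ f ∙ J (σ _ Y)) †ₖ
      ≡⟨ trans (†ₖ-homomorphism _ _) (cong (_∙ J (σ Y _) †ₖ) (†ₖ-homomorphism _ _)) ⟩
    (J (σ _ Y) †ₖ ∙ (Y ⊗ˡ f) †ₖ) ∙ J (σ Y _) †ₖ
      ≡⟨ cong₂ (λ u v → (u ∙ (Y ⊗ˡ f) †ₖ) ∙ v) (trans (†ₖ-J _) (cong J σ-†)) (trans (†ₖ-J _) (cong J σ-†)) ⟩
    (J (σ Y _) ∙ (Y ⊗ˡ f) †ₖ) ∙ J (σ _ Y)
      ≡⟨ trans (∙-assoc _ _ _) (cong (λ z → J (σ Y _) ∙ z ∙ J (σ _ Y)) (†ₖ-⊗ˡ Y f)) ⟩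
    J (σ Y _) ∙ Y ⊗ˡ (f †ₖ) ∙ J (σ _ Y)
      ≡⟨ sym (⊗ʳ-conjugate Y (f †ₖ)) ⟩
    (f †ₖ) ⊗ʳ Y ∎

  †ₖ-⊗ₖ : ∀ {A B A' B'} (f : Hom A (T₀ B)) (g : Hom A' (T₀ B')) → (f ⊗ₖ g) †ₖ ≡ f †ₖ ⊗ₖ g †ₖ
  †ₖ-⊗ₖ f g = begin
    (f ⊗ₖ g) †ₖ                    ≡⟨ cong _†ₖ (⊗ₖ≡⊗ʳ∙⊗ˡ f g) ⟩
    (f ⊗ʳ _ ∙ _ ⊗ˡ g) †ₖ           ≡⟨ †ₖ-homomorphism _ _ ⟩
    (_ ⊗ˡ g) †ₖ ∙ (f ⊗ʳ _) †ₖ      ≡⟨ cong₂ _∙_ (†ₖ-⊗ˡ _ g) (†ₖ-⊗ʳ _ f) ⟩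
    _ ⊗ˡ (g †ₖ) ∙ (f †ₖ) ⊗ʳ _      ≡⟨ sym (⊗ʳ-⊗ˡ-interchange (f †ₖ) (g †ₖ)) ⟩
    (f †ₖ) ⊗ʳ _ ∙ _ ⊗ˡ (g †ₖ)      ≡⟨ sym (⊗ₖ≡⊗ʳ∙⊗ˡ _ _) ⟩
    f †ₖ ⊗ₖ g †ₖ                   ∎

  J-preserves-unitary : ∀ {A B} {f : Hom A B} → IsUnitary raw † f → IsUnitary kleisli _†ₖ (J f)
  J-preserves-unitary (†f∘f≡id , f∘†f≡id) =
    trans (cong (_∙ J _) (†ₖ-J _)) (J-inverse †f∘f≡id) ,
    trans (cong (J _ ∙_) (†ₖ-J _)) (J-inverse f∘†f≡id)

  kleisli-isSymmetricMonoidalDagger : IsSymmetricMonoidalDagger kleisli kleisli-† kleisli-monoidal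
  kleisli-isSymmetricMonoidalDagger = record
    { isCategory = kleisli-isCategory
    ; isDagger = record
      { †-identity = †ₖ-identity ; †-homomorphism = †ₖ-homomorphism ; †-involutive = †ₖ-involutive }
    ; isSymmetricMonoidal = kleisli-isSymmetricMonoidal
    ; †-⊗ = †ₖ-⊗ₖ
    ; α-unitary = λ A B C → J-preserves-unitary (α-unitary A B C)
    ; λ-unitary = λ A → J-preserves-unitary (λ-unitary A)
    ; ρ-unitary = λ A → J-preserves-unitary (ρ-unitary A)
    ; σ-unitary = λ A B → J-preserves-unitary (σ-unitary A B)
    }

theorem5p4 : ∀ {o ℓ} (𝒞 : SymmetricMonoidalDaggerCategory o ℓ) (𝕋 : Monad 𝒞)
    (st : ∀ A B → SymmetricMonoidalDaggerCategory.Hom 𝒞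
            (SymmetricMonoidalDaggerCategory._⊗₀_ 𝒞 A (Monad.T₀ 𝕋 B))
            (Monad.T₀ 𝕋 (SymmetricMonoidalDaggerCategory._⊗₀_ 𝒞 A B))) →
    Strength.IsCommutativeStrongFrobenius 𝒞 𝕋 st →
    IsSymmetricMonoidalDagger (Strength.kleisli 𝒞 𝕋 st)
      (Strength.kleisli-† 𝒞 𝕋 st) (Strength.kleisli-monoidal 𝒞 𝕋 st)
theorem5p4 𝒞 𝕋 st isCommutativeStrongFrobenius =
  KleisliSymmetricMonoidalDagger.kleisli-isSymmetricMonoidalDagger 𝒞 𝕋 st isCommutativeStrongFrobenius
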